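{- Let $n,c$ be positive integers and $a\in\{1,\dots,c\}$. Then $$\left|\Pi_n^{eq}\wr C_c(1^a2^a1^a)\right|=B(n)(c-1)^n+\sum_{i=1}^n\sum_{r=1}^i\binom{n}{i}\binom{i}{r}B(n-i)(c-1)^{n-r}$$ $$+\sum_{i=2}^n\sum_{\ell=2}^i\sum_{j=0}^{n-i}\binom{n}{i}\binom{i-1}{\ell-1}\binom{n-i}{j}\ell^jB(n-i-j)(c-1)^{n-i}.$$
   Context: $\Pi_n\wr C_c$ is the set of colored set partitions of $[n]$: a set partition of $[n]$ together with a color in $\{1,\dots,c\}$ for each element. A colored partition eq-contains $1^a2^a1^a$ iff there are elements $x<y<z$, all colored $a$, with $x$ and $z$ in the same block and $y$ in a different block; $\Pi_n^{eq}\wr C_c(1^a2^a1^a)$ is the set of those that do not. $B(m)$ is the $m$-th Bell number. -}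

module Defs where

open import Data.Nat using (ℕ; zero; suc; _+_; _*_; _∸_; _<_)
open import Data.Nat.Combinatorics using (_C_)
open import Data.Fin using (Fin; toℕ; fromℕ) renaming (_<_ to _<ᶠ_)
open import Data.Vec using (Vec; []; _∷_; lookup; _∷ʳ_; tabulate; last; toList)
open import Data.List using (List; applyUpTo; length)
open import Data.Nat.ListAction using (sum)
open import Data.List.Membership.Propositional using (_∈_)
open import Data.List.Relation.Unary.Unique.Propositional using (Unique)
open import Data.Product using (_×_; Σ; ∃-syntax; _,_; proj₁)
open import Function.Bundles using (_⇔_)
open import Relation.Binary.PropositionalEquality using (_≡_; _≢_)
open import Relation.Nullary using (¬_)

-- ∑ lo hi f = Σ_{k=lo}^{hi} f k  (empty when hi < lo)
∑ : ℕ → ℕ → (ℕ → ℕ) → ℕ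
∑ lo hi f = sum (applyUpTo (λ k → f (lo + k)) (suc hi ∸ lo))

-- Bell numbers via B(0) = 1, B(m+1) = Σ_{k=0}^{m} C(m,k) B(k).
-- bells m = [B 0, …, B m]
bells : (m : ℕ) → Vec ℕ (suc m)
bells zero = 1 ∷ []
bells (suc m) = bells m ∷ʳ sum (toList (tabulate {n = suc m}
                  (λ k → (m C toℕ k) * lookup (bells m) k)))

B : ℕ → ℕ
B m = last (bells m)

-- Set partitions of [n] encoded canonically as restricted growth strings:
-- element i lies in block v[i]; blocks are numbered in order of their
-- smallest element.  RGS k v : v is a valid continuation when k blocks
-- have been opened so far.
data RGS : ℕ → {n : ℕ} → Vec ℕ n → Set where
  done : ∀ {k} → RGS k []
  old  : ∀ {k n x} {v : Vec ℕ n} → x < k → RGS k v → RGS k (x ∷ v)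
  new  : ∀ {k n} {v : Vec ℕ n} → RGS (suc k) v → RGS k (k ∷ v)

IsSetPartition : {n : ℕ} → Vec ℕ n → Set
IsSetPartition v = RGS 0 v

-- a colored set partition: block-labels (RGS) together with a colour
-- in Fin c (colours 1..c ↦ 0..c-1) for each element
ColoredData : ℕ → ℕ → Set
ColoredData n c = Vec ℕ n × Vec (Fin c) n

Contains121 : ∀ {n c} → Fin c → ColoredData n c → Set
Contains121 {n} a (v , col) =
  ∃[ x ] ∃[ y ] ∃[ z ]
    (x <ᶠ y × y <ᶠ z
     × lookup col x ≡ a × lookup col y ≡ a × lookup col z ≡ a
     × lookup v x ≡ lookup v z × lookup v y ≢ lookup v x)

InAvoidSet : ∀ {n c} → Fin c → ColoredData n c → Set
InAvoidSet a p = IsSetPartition (proj₁ p) × ¬ Contains121 a p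

HasCard : {A : Set} → (A → Set) → ℕ → Set
HasCard {A} P N = Σ (List A) (λ L → Unique L × (∀ p → (p ∈ L) ⇔ P p)
                                 × length L ≡ N)

-- Read left to right, the pattern occurs exactly when an a-coloured entry
-- returns to a block already holding an a-entry while the previous a-entry
-- lies in another block.  A scan remembering the open blocks, the blocks
-- with an a-entry and the block of the last a-entry therefore decides
-- avoidance (Scan), and `enumerate` lists the accepted strings step by step:
-- it is sound, complete and repetition-free (Enumeration).  Its length is
-- `count`, a recurrence in the number k of open blocks, the number p of
-- them without a-entry and whether an a-entry occurred.  Splitting by the
-- number of a-entries and using Bell-type numbers bellExt ℓ r (partitions
-- with ℓ extra blocks) solves it in closed form (count-closedForm), after
-- finite-sum and binomial identities developed first.
module Submission where

open import Defs
open import Data.Nat using (ℕ; zero; suc; _+_; _*_; _∸_; _^_; _≤_; _<_; z≤n; s≤s; _!; NonZero; _⊔_)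
open import Data.Nat.Properties
open import Data.Nat.DivMod using (_/_; m/n*n≡m)
open import Data.Nat.Combinatorics
  using (_C_; nCk+nC[k+1]≡[n+1]C[k+1]; nCk≡nC[n∸k]; k>n⇒nCk≡0; nCk≡n!/k![n-k]!; k![n∸k]!∣n!)
open import Data.Nat.ListAction using (sum)
open import Data.Nat.Solver using (module +-*-Solver)
open import Data.Fin using (Fin; toℕ; punchIn) renaming (zero to fz; suc to fs; _≟_ to _≟ᶠ_)
open import Data.Fin.Properties using (punchIn-injective; punchInᵢ≢i; punchIn-punchOut)
open import Data.Vec using (Vec; []; _∷_; lookup; _∷ʳ_; tabulate; toList; last)
open import Data.Vec.Properties using (last-∷ʳ)
open import Data.Bool using (Bool; true; false; if_then_else_)
import Data.Bool.Properties as Bool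
open import Data.Maybe using (Maybe; just; nothing)
import Data.Maybe.Properties as Maybe
open import Data.Product using (_×_; Σ; ∃; _,_; proj₁; proj₂)
open import Data.Sum using (_⊎_; inj₁; inj₂)
open import Data.Empty using (⊥; ⊥-elim)
open import Data.List using (List; []; _∷_; _++_; map; concatMap; filter; upTo; applyUpTo; allFin; length)
open import Data.List.Properties using (length-++; length-map; length-tabulate)
open import Data.List.Membership.Propositional using (_∈_; find; lose)
open import Data.List.Membership.Propositional.Properties
  using (∈-++⁺ˡ; ∈-++⁺ʳ; ∈-++⁻; ∈-concatMap⁺; ∈-concatMap⁻; ∈-map⁺; ∈-map⁻;
         ∈-filter⁺; ∈-filter⁻; ∈-upTo⁺; ∈-upTo⁻; ∈-allFin)
open import Data.List.Relation.Unary.Any using (here)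
open import Data.List.Relation.Unary.All using ([])
import Data.List.Relation.Unary.All as All
open import Data.List.Relation.Unary.AllPairs using ([]; _∷_)
open import Data.List.Relation.Unary.Unique.Propositional using (Unique)
open import Data.List.Relation.Unary.Unique.Propositional.Properties
  using (map⁺; ++⁺; filter⁺; upTo⁺; allFin⁺)
open import Function.Bundles using (_⇔_; mk⇔; Equivalence)
open import Relation.Nullary using (¬_; yes; no; Dec)
open import Relation.Nullary.Decidable using (¬?; _×-dec_)
open import Relation.Binary.PropositionalEquality
open +-*-Solver
open ≡-Reasoning

-- ∑< n f = f 0 + f 1 + … + f (n ∸ 1).  The definition is opaque so that
-- sums are manipulated only through the lemmas below and never unfolded
-- during conversion checking.
opaque
  ∑< : ℕ → (ℕ → ℕ) → ℕ
  ∑< zero    f = 0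
  ∑< (suc n) f = f 0 + ∑< n (λ j → f (suc j))

  ∑<-0 : ∀ (f : ℕ → ℕ) → ∑< 0 f ≡ 0
  ∑<-0 f = refl

  ∑<-suc : ∀ n (f : ℕ → ℕ) → ∑< (suc n) f ≡ f 0 + ∑< n (λ j → f (suc j))
  ∑<-suc n f = refl

  ∑≡∑< : ∀ lo hi f → ∑ lo hi f ≡ ∑< (suc hi ∸ lo) (λ k → f (lo + k))
  ∑≡∑< lo hi f = sum-applyUpTo (suc hi ∸ lo) (λ k → f (lo + k))
    where
    sum-applyUpTo : ∀ n (g : ℕ → ℕ) → sum (applyUpTo g n) ≡ ∑< n g
    sum-applyUpTo zero    g = refl
    sum-applyUpTo (suc n) g = cong (g 0 +_) (sum-applyUpTo n (λ j → g (suc j)))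

  ∑<-cong : ∀ n {f g : ℕ → ℕ} → (∀ i → i < n → f i ≡ g i) → ∑< n f ≡ ∑< n g
  ∑<-cong zero    f≗g = refl
  ∑<-cong (suc n) f≗g = cong₂ _+_ (f≗g 0 (s≤s z≤n)) (∑<-cong n (λ i i<n → f≗g (suc i) (s≤s i<n)))

  ∑<-+ : ∀ n (f g : ℕ → ℕ) → ∑< n (λ i → f i + g i) ≡ ∑< n f + ∑< n g
  ∑<-+ zero    f g = refl
  ∑<-+ (suc n) f g = begin
    f 0 + g 0 + ∑< n (λ i → f (suc i) + g (suc i))
      ≡⟨ cong (f 0 + g 0 +_) (∑<-+ n (λ i → f (suc i)) (λ i → g (suc i))) ⟩
    f 0 + g 0 + (F + G)
      ≡⟨ solve 4 (λ a b x y → a :+ b :+ (x :+ y) := a :+ x :+ (b :+ y)) refl (f 0) (g 0) F G ⟩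
    f 0 + F + (g 0 + G) ∎
    where
    F G : ℕ
    F = ∑< n (λ i → f (suc i))
    G = ∑< n (λ i → g (suc i))

  ∑<-* : ∀ n k (f : ℕ → ℕ) → ∑< n (λ i → k * f i) ≡ k * ∑< n f
  ∑<-* zero    k f = sym (*-zeroʳ k)
  ∑<-* (suc n) k f = trans (cong (k * f 0 +_) (∑<-* n k (λ i → f (suc i))))
                           (sym (*-distribˡ-+ k (f 0) _))

  ∑<-last : ∀ n (f : ℕ → ℕ) → ∑< (suc n) f ≡ ∑< n f + f n
  ∑<-last zero    f = +-comm (f 0) 0
  ∑<-last (suc n) f = trans (cong (f 0 +_) (∑<-last n (λ j → f (suc j))))
                            (sym (+-assoc (f 0) _ _))

∑<-const : ∀ n c → ∑< n (λ _ → c) ≡ n * c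
∑<-const zero    c = ∑<-0 _
∑<-const (suc n) c = trans (∑<-suc n _) (cong (c +_) (∑<-const n c))

∑<-zero : ∀ n {f : ℕ → ℕ} → (∀ i → i < n → f i ≡ 0) → ∑< n f ≡ 0
∑<-zero n f≗0 = trans (∑<-cong n f≗0) (trans (∑<-const n 0) (*-zeroʳ n))

∑<-reverse : ∀ n (f : ℕ → ℕ) → ∑< n (λ j → f (n ∸ suc j)) ≡ ∑< n f
∑<-reverse zero    f = trans (∑<-0 _) (sym (∑<-0 f))
∑<-reverse (suc n) f = begin
  ∑< (suc n) (λ j → f (suc n ∸ suc j))   ≡⟨ ∑<-suc n _ ⟩
  f n + ∑< n (λ j → f (n ∸ suc j))       ≡⟨ cong (f n +_) (∑<-reverse n f) ⟩
  f n + ∑< n f                           ≡⟨ +-comm (f n) _ ⟩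
  ∑< n f + f n                           ≡⟨ ∑<-last n f ⟨
  ∑< (suc n) f                           ∎

∑<-triangle : ∀ n (F : ℕ → ℕ → ℕ) →
  ∑< n (λ i → ∑< (n ∸ i) (λ j → F i (i + j))) ≡ ∑< n (λ s → ∑< (suc s) (λ t → F t s))
∑<-triangle zero    F = trans (∑<-0 _) (sym (∑<-0 _))
∑<-triangle (suc n) F = begin
  ∑< (suc n) (λ i → ∑< (suc n ∸ i) (λ j → F i (i + j)))
    ≡⟨ ∑<-cong (suc n) (λ i i<1+n → peelLast i (≤-pred i<1+n)) ⟩
  ∑< (suc n) (λ i → ∑< (n ∸ i) (λ j → F i (i + j)) + F i n)
    ≡⟨ ∑<-+ (suc n) _ _ ⟩
  ∑< (suc n) (λ i → ∑< (n ∸ i) (λ j → F i (i + j))) + ∑< (suc n) (λ i → F i n)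
    ≡⟨ cong (_+ ∑< (suc n) (λ i → F i n)) dropEmpty ⟩
  ∑< n (λ i → ∑< (n ∸ i) (λ j → F i (i + j))) + ∑< (suc n) (λ i → F i n)
    ≡⟨ cong (_+ ∑< (suc n) (λ i → F i n)) (∑<-triangle n F) ⟩
  ∑< n (λ s → ∑< (suc s) (λ t → F t s)) + ∑< (suc n) (λ i → F i n)
    ≡⟨ ∑<-last n _ ⟨
  ∑< (suc n) (λ s → ∑< (suc s) (λ t → F t s)) ∎
  where
  peelLast : ∀ i → i ≤ n → ∑< (suc n ∸ i) (λ j → F i (i + j)) ≡ ∑< (n ∸ i) (λ j → F i (i + j)) + F i n
  peelLast i i≤n = begin
    ∑< (suc n ∸ i) (λ j → F i (i + j))
      ≡⟨ cong (λ z → ∑< z (λ j → F i (i + j))) (+-∸-assoc 1 i≤n) ⟩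
    ∑< (suc (n ∸ i)) (λ j → F i (i + j))
      ≡⟨ ∑<-last (n ∸ i) _ ⟩
    ∑< (n ∸ i) (λ j → F i (i + j)) + F i (i + (n ∸ i))
      ≡⟨ cong (λ z → ∑< (n ∸ i) (λ j → F i (i + j)) + F i z) (m+[n∸m]≡n i≤n) ⟩
    ∑< (n ∸ i) (λ j → F i (i + j)) + F i n ∎
  -- the row i = n of the left-hand side is empty
  dropEmpty : ∑< (suc n) (λ i → ∑< (n ∸ i) (λ j → F i (i + j))) ≡ ∑< n (λ i → ∑< (n ∸ i) (λ j → F i (i + j)))
  dropEmpty = trans (∑<-last n _)
    (trans (cong (λ z → rows + ∑< z (λ j → F n (n + j))) (n∸n≡0 n))
      (trans (cong (rows +_) (∑<-0 _)) (+-identityʳ rows)))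
    where
    rows : ℕ
    rows = ∑< n (λ i → ∑< (n ∸ i) (λ j → F i (i + j)))

∑<-pascal : ∀ i (f : ℕ → ℕ) →
  ∑< (suc (suc i)) (λ s → (suc i C s) * f s)
    ≡ ∑< (suc i) (λ s → (i C s) * f s) + ∑< (suc i) (λ s → (i C s) * f (suc s))
∑<-pascal i f = begin
  ∑< (suc (suc i)) (λ s → (suc i C s) * f s)
    ≡⟨ ∑<-suc (suc i) _ ⟩
  f0 + ∑< (suc i) (λ s → (suc i C suc s) * f (suc s))
    ≡⟨ cong (f0 +_) (∑<-cong (suc i) (λ s _ → pascal s)) ⟩
  f0 + ∑< (suc i) (λ s → (i C s) * f (suc s) + (i C suc s) * f (suc s))
    ≡⟨ cong (f0 +_) (∑<-+ (suc i) _ _) ⟩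
  f0 + (X + ∑< (suc i) (λ s → (i C suc s) * f (suc s)))
    ≡⟨ cong (λ z → f0 + (X + z)) dropTop ⟩
  f0 + (X + Y)
    ≡⟨ solve 3 (λ a x y → a :+ (x :+ y) := a :+ y :+ x) refl f0 X Y ⟩
  (f0 + Y) + X
    ≡⟨ cong (_+ X) (∑<-suc i _) ⟨
  ∑< (suc i) (λ s → (i C s) * f s) + X ∎
  where
  f0 X Y : ℕ
  f0 = 1 * f 0
  X = ∑< (suc i) (λ s → (i C s) * f (suc s))
  Y = ∑< i (λ s → (i C suc s) * f (suc s))
  pascal : ∀ s → (suc i C suc s) * f (suc s) ≡ (i C s) * f (suc s) + (i C suc s) * f (suc s)
  pascal s = trans (cong (_* f (suc s)) (sym (nCk+nC[k+1]≡[n+1]C[k+1] i s)))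
                   (*-distribʳ-+ (f (suc s)) (i C s) (i C suc s))
  -- the term C(i, i+1) vanishes
  dropTop : ∑< (suc i) (λ s → (i C suc s) * f (suc s)) ≡ Y
  dropTop = trans (∑<-last i _)
    (trans (cong (λ z → Y + z * f (suc i)) (k>n⇒nCk≡0 (n<1+n i))) (+-identityʳ Y))

C-factorial : ∀ a b → ((a + b) C a) * (a ! * b !) ≡ (a + b) !
C-factorial a b = begin
  ((a + b) C a) * (a ! * b !)
    ≡⟨ cong (λ z → ((a + b) C a) * (a ! * z !)) (m+n∸m≡n a b) ⟨
  ((a + b) C a) * D
    ≡⟨ cong (_* D) (nCk≡n!/k![n-k]! (m≤m+n a b)) ⟩
  (a + b) ! / D * D
    ≡⟨ m/n*n≡m (k![n∸k]!∣n! (m≤m+n a b)) ⟩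
  (a + b) ! ∎
  where
  D : ℕ
  D = a ! * (a + b ∸ a) !
  instance
    D≢0 : NonZero D
    D≢0 = a !* (a + b ∸ a) !≢0

-- Choosing i elements and then j of the remaining ones is choosing i + j
-- elements and then which i of them come first.
C-subset-of-subset : ∀ i j m →
  ((i + (j + m)) C i) * ((j + m) C j) ≡ ((i + (j + m)) C (i + j)) * ((i + j) C i)
C-subset-of-subset i j m = *-cancelʳ-≡ _ _ (i ! * (j ! * m !)) {{i!j!m!≢0}} (begin
  ((N C i) * ((j + m) C j)) * (i ! * (j ! * m !))
    ≡⟨ solve 5 (λ x y I J M → x :* y :* (I :* (J :* M)) := x :* (I :* (y :* (J :* M))))
             refl (N C i) ((j + m) C j) (i !) (j !) (m !) ⟩
  (N C i) * (i ! * (((j + m) C j) * (j ! * m !)))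
    ≡⟨ cong (λ z → (N C i) * (i ! * z)) (C-factorial j m) ⟩
  (N C i) * (i ! * (j + m) !)
    ≡⟨ C-factorial i (j + m) ⟩
  N !
    ≡⟨ cong _! (+-assoc i j m) ⟨
  (i + j + m) !
    ≡⟨ C-factorial (i + j) m ⟨
  ((i + j + m) C (i + j)) * ((i + j) ! * m !)
    ≡⟨ cong (λ z → (z C (i + j)) * ((i + j) ! * m !)) (+-assoc i j m) ⟩
  (N C (i + j)) * ((i + j) ! * m !)
    ≡⟨ cong (λ z → (N C (i + j)) * (z * m !)) (C-factorial i j) ⟨
  (N C (i + j)) * ((((i + j) C i) * (i ! * j !)) * m !)
    ≡⟨ solve 5 (λ x y I J M → x :* ((y :* (I :* J)) :* M) := x :* y :* (I :* (J :* M)))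
             refl (N C (i + j)) ((i + j) C i) (i !) (j !) (m !) ⟩
  ((N C (i + j)) * ((i + j) C i)) * (i ! * (j ! * m !)) ∎)
  where
  N : ℕ
  N = i + (j + m)
  i!j!m!≢0 : NonZero (i ! * (j ! * m !))
  i!j!m!≢0 = m*n≢0 (i !) (j ! * m !) {{i !≢0}} {{j !* m !≢0}}

B-suc : ∀ m → B (suc m) ≡ ∑< (suc m) (λ k → (m C k) * B k)
B-suc m = trans (last-∷ʳ next (bells m))
  (sum-tabulate (suc m) _ _ (λ i → cong ((m C toℕ i) *_) (bells-lookup m i)))
  where
  next : ℕ
  next = sum (toList (tabulate {n = suc m} (λ k → (m C toℕ k) * lookup (bells m) k)))

  lookup-∷ʳ : ∀ {n} (xs : Vec ℕ n) x (f : ℕ → ℕ) → (∀ i → lookup xs i ≡ f (toℕ i)) → x ≡ f n →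
              ∀ i → lookup (xs ∷ʳ x) i ≡ f (toℕ i)
  lookup-∷ʳ []       x f xs≗f x≡fn fz     = x≡fn
  lookup-∷ʳ (y ∷ xs) x f xs≗f x≡fn fz     = xs≗f fz
  lookup-∷ʳ (y ∷ xs) x f xs≗f x≡fn (fs i) =
    lookup-∷ʳ xs x (λ k → f (suc k)) (λ i → xs≗f (fs i)) x≡fn i

  bells-lookup : ∀ m (i : Fin (suc m)) → lookup (bells m) i ≡ B (toℕ i)
  bells-lookup zero    fz = refl
  bells-lookup (suc m) = lookup-∷ʳ (bells m) _ B (bells-lookup m) (sym (last-∷ʳ _ (bells m)))

  sum-tabulate : ∀ n (g : Fin n → ℕ) (h : ℕ → ℕ) → (∀ i → g i ≡ h (toℕ i)) →
                 sum (toList (tabulate g)) ≡ ∑< n h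
  sum-tabulate zero    g h g≗h = sym (∑<-0 h)
  sum-tabulate (suc n) g h g≗h =
    trans (cong₂ _+_ (g≗h fz) (sum-tabulate n (λ i → g (fs i)) (λ k → h (suc k)) (λ i → g≗h (fs i))))
          (sym (∑<-suc n h))

-- bellExt ℓ r counts the ways to place r further elements, one after the
-- other, each into one of the ℓ blocks already present or into a new block:
-- set partitions of [r] together with ℓ extra blocks available.
bellExt : ℕ → ℕ → ℕ
bellExt ℓ zero    = 1
bellExt ℓ (suc r) = ℓ * bellExt ℓ r + bellExt (suc ℓ) r

-- Splitting off m of the available blocks: the j elements placed into
-- those m blocks can be chosen in C(r,j) ways and placed in m^j ways.
bellExt-shift : ∀ r ℓ m → bellExt (ℓ + m) r ≡ ∑< (suc r) (λ j → (r C j) * m ^ j * bellExt ℓ (r ∸ j))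
bellExt-shift zero ℓ m = sym (trans (∑<-suc 0 _) (cong (1 +_) (∑<-0 _)))
bellExt-shift (suc r) ℓ m = begin
  (ℓ + m) * bellExt (ℓ + m) r + bellExt (suc ℓ + m) r
    ≡⟨ cong₂ (λ u v → (ℓ + m) * u + v) (bellExt-shift r ℓ m) (bellExt-shift r (suc ℓ) m) ⟩
  (ℓ + m) * X + Y
    ≡⟨ solve 4 (λ l m X Y → (l :+ m) :* X :+ Y := (l :* X :+ Y) :+ m :* X) refl ℓ m X Y ⟩
  (ℓ * X + Y) + m * X
    ≡⟨ cong₂ _+_ (sym unshifted) (sym shifted) ⟩
  ∑< (suc r) (λ j → (r C j) * f j) + ∑< (suc r) (λ j → (r C j) * f (suc j))
    ≡⟨ ∑<-pascal r f ⟨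
  ∑< (suc (suc r)) (λ j → (suc r C j) * f j)
    ≡⟨ ∑<-cong (suc (suc r)) (λ j _ → sym (*-assoc (suc r C j) (m ^ j) _)) ⟩
  ∑< (suc (suc r)) (λ j → (suc r C j) * m ^ j * bellExt ℓ (suc r ∸ j)) ∎
  where
  f : ℕ → ℕ
  f j = m ^ j * bellExt ℓ (suc r ∸ j)
  X Y : ℕ
  X = ∑< (suc r) (λ j → (r C j) * m ^ j * bellExt ℓ (r ∸ j))
  Y = ∑< (suc r) (λ j → (r C j) * m ^ j * bellExt (suc ℓ) (r ∸ j))
  unshifted : ∑< (suc r) (λ j → (r C j) * f j) ≡ ℓ * X + Y
  unshifted = begin
    ∑< (suc r) (λ j → (r C j) * f j)
      ≡⟨ ∑<-cong (suc r) (λ j j<1+r → unfold j (≤-pred j<1+r)) ⟩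
    ∑< (suc r) (λ j → ℓ * ((r C j) * m ^ j * bellExt ℓ (r ∸ j)) + (r C j) * m ^ j * bellExt (suc ℓ) (r ∸ j))
      ≡⟨ ∑<-+ (suc r) _ _ ⟩
    ∑< (suc r) (λ j → ℓ * ((r C j) * m ^ j * bellExt ℓ (r ∸ j))) + Y
      ≡⟨ cong (_+ Y) (∑<-* (suc r) ℓ _) ⟩
    ℓ * X + Y ∎
    where
    unfold : ∀ j → j ≤ r →
      (r C j) * f j ≡ ℓ * ((r C j) * m ^ j * bellExt ℓ (r ∸ j)) + (r C j) * m ^ j * bellExt (suc ℓ) (r ∸ j)
    unfold j j≤r = begin
      (r C j) * (m ^ j * bellExt ℓ (suc r ∸ j))
        ≡⟨ cong (λ z → (r C j) * (m ^ j * bellExt ℓ z)) (+-∸-assoc 1 j≤r) ⟩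
      (r C j) * (m ^ j * (ℓ * bellExt ℓ (r ∸ j) + bellExt (suc ℓ) (r ∸ j)))
        ≡⟨ solve 5 (λ b p l t u → b :* (p :* (l :* t :+ u)) := l :* (b :* p :* t) :+ b :* p :* u)
                 refl (r C j) (m ^ j) ℓ (bellExt ℓ (r ∸ j)) (bellExt (suc ℓ) (r ∸ j)) ⟩
      ℓ * ((r C j) * m ^ j * bellExt ℓ (r ∸ j)) + (r C j) * m ^ j * bellExt (suc ℓ) (r ∸ j) ∎
  shifted : ∑< (suc r) (λ j → (r C j) * f (suc j)) ≡ m * X
  shifted = trans
    (∑<-cong (suc r) (λ j _ → solve 4 (λ b m p t → b :* ((m :* p) :* t) := m :* (b :* p :* t))
                                      refl (r C j) m (m ^ j) (bellExt ℓ (r ∸ j))))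
    (∑<-* (suc r) m _)

-- With no extra blocks, bellExt is the Bell number: by the shift with one
-- block, bellExt 1 s satisfies the Bell recurrence.
bellExt-0 : ∀ r → bellExt 0 r ≡ B r
bellExt-0 r = bounded r r ≤-refl
  where
  -- induction on the bound r, as the recurrence refers to all s ∸ j
  bounded : ∀ r s → s ≤ r → bellExt 0 s ≡ B s
  bounded r       zero    _       = refl
  bounded (suc r) (suc s) (s≤s s≤r) = begin
    bellExt 1 s
      ≡⟨ bellExt-shift s 0 1 ⟩
    ∑< (suc s) (λ j → (s C j) * 1 ^ j * bellExt 0 (s ∸ j))
      ≡⟨ ∑<-cong (suc s) (λ j _ → cong₂ _*_ (trans (cong ((s C j) *_) (^-zeroˡ j)) (*-identityʳ (s C j)))
                                            (bounded r (s ∸ j) (≤-trans (m∸n≤m s j) s≤r))) ⟩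
    ∑< (suc s) (λ j → (s C j) * B (s ∸ j))
      ≡⟨ ∑<-cong (suc s) (λ j j<1+s → cong (λ z → (s C z) * B (s ∸ j)) (sym (m∸[m∸n]≡n (≤-pred j<1+s)))) ⟩
    ∑< (suc s) (λ j → (s C (s ∸ (s ∸ j))) * B (s ∸ j))
      ≡⟨ ∑<-reverse (suc s) (λ k → (s C (s ∸ k)) * B k) ⟩
    ∑< (suc s) (λ k → (s C (s ∸ k)) * B k)
      ≡⟨ ∑<-cong (suc s) (λ k k<1+s → cong (_* B k) (sym (nCk≡nC[n∸k] (≤-pred k<1+s)))) ⟩
    ∑< (suc s) (λ k → (s C k) * B k)
      ≡⟨ B-suc s ⟨
    B (suc s) ∎

bellExt-closed : ∀ ℓ r → bellExt ℓ r ≡ ∑< (suc r) (λ j → (r C j) * ℓ ^ j * B (r ∸ j))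
bellExt-closed ℓ r = trans (bellExt-shift r 0 ℓ)
  (∑<-cong (suc r) (λ j _ → cong ((r C j) * ℓ ^ j *_) (bellExt-0 (r ∸ j))))

-- A scan state of a coloured restricted growth string is summarised by
-- k (blocks opened so far), p (how many of them contain no a-coloured
-- element) and e (1 once an a-coloured element has occurred, else 0).
-- count d m k p e is the number of admissible continuations of length m
-- when d colours other than a are available.  An element of another
-- colour joins any of the k blocks or opens a new one; an a-coloured
-- element joins a block without a-element (p ways), the block of the last
-- a-element (e ways) or a new block.
count : ℕ → ℕ → ℕ → ℕ → ℕ → ℕ
count d zero    k p e = 1
count d (suc m) k p e =
  d * (k * count d m k p e + count d m (suc k) (suc p) e)
  + (p * count d m k (p ∸ 1) 1 + e * count d m k p 1 + count d m (suc k) p 1)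

-- countA i r k p e counts the continuations consisting of i a-coloured
-- elements followed by r elements of one fixed other colour.
countA : ℕ → ℕ → ℕ → ℕ → ℕ → ℕ
countA zero    r k p e = bellExt k r
countA (suc i) r k p e = p * countA i r k (p ∸ 1) 1 + e * countA i r k p 1 + countA i r (suc k) p 1

-- The order of the two kinds of steps does not matter: countA also obeys
-- the recurrence of a first step of the other colour.
countA-otherFirst : ∀ i r k p e → countA i (suc r) k p e ≡ k * countA i r k p e + countA i r (suc k) (suc p) e
countA-otherFirst zero    r k p e = refl
countA-otherFirst (suc i) r k p e = begin
  p * countA i (suc r) k (p ∸ 1) 1 + e * countA i (suc r) k p 1 + countA i (suc r) (suc k) p 1
    ≡⟨ cong₂ _+_ (cong₂ _+_ (cong (p *_) (countA-otherFirst i r k (p ∸ 1) 1))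
                            (cong (e *_) (countA-otherFirst i r k p 1)))
                 (countA-otherFirst i r (suc k) p 1) ⟩
  p * (k * A + A′) + e * (k * Bq + Bq′) + (suc k * Cq + Cq′)
    ≡⟨ cong (λ z → z + e * (k * Bq + Bq′) + (suc k * Cq + Cq′))
            (trans (*-distribˡ-+ p (k * A) A′)
                   (cong (p * (k * A) +_) (weighted-pred p (λ q → countA i r (suc k) q 1)))) ⟩
  (p * (k * A) + p * Cq) + e * (k * Bq + Bq′) + (suc k * Cq + Cq′)
    ≡⟨ solve 8 (λ p e k A Bq Bq′ Cq Cq′ →
                  (p :* (k :* A) :+ p :* Cq) :+ e :* (k :* Bq :+ Bq′) :+ ((con 1 :+ k) :* Cq :+ Cq′)
                  := k :* (p :* A :+ e :* Bq :+ Cq) :+ ((con 1 :+ p) :* Cq :+ e :* Bq′ :+ Cq′))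
             refl p e k A Bq Bq′ Cq Cq′ ⟩
  k * (p * A + e * Bq + Cq) + (suc p * Cq + e * Bq′ + Cq′) ∎
  where
  A A′ Bq Bq′ Cq Cq′ : ℕ
  A   = countA i r k (p ∸ 1) 1
  A′  = countA i r (suc k) (suc (p ∸ 1)) 1
  Bq  = countA i r k p 1
  Bq′ = countA i r (suc k) (suc p) 1
  Cq  = countA i r (suc k) p 1
  Cq′ = countA i r (suc (suc k)) (suc p) 1
  -- for p = 0 the factor p hides the difference between suc (p ∸ 1) and p
  weighted-pred : ∀ q (g : ℕ → ℕ) → q * g (suc (q ∸ 1)) ≡ q * g q
  weighted-pred zero    g = refl
  weighted-pred (suc q) g = refl

-- Splitting by the number i of a-coloured elements among the m:
-- count d m k p e = Σ_{i≤m} C(m,i) d^(m-i) countA i (m-i) k p e.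
module _ (d : ℕ) where

  splitTerm : ℕ → ℕ → ℕ → ℕ → ℕ → ℕ
  splitTerm m k p e i = (m C i) * (d ^ (m ∸ i) * countA i (m ∸ i) k p e)

  longerTerm : ℕ → ℕ → ℕ → ℕ → ℕ → ℕ
  longerTerm m k p e i = d ^ (suc m ∸ i) * countA i (suc m ∸ i) k p e

  split-otherFirst : ∀ m k p e →
    ∑< (suc m) (λ i → (m C i) * longerTerm m k p e i)
    ≡ d * (k * ∑< (suc m) (splitTerm m k p e) + ∑< (suc m) (splitTerm m (suc k) (suc p) e))
  split-otherFirst m k p e = begin
    ∑< (suc m) (λ i → (m C i) * longerTerm m k p e i)
      ≡⟨ ∑<-cong (suc m) (λ i i<1+m → termwise i (≤-pred i<1+m)) ⟩
    ∑< (suc m) (λ i → d * (k * splitTerm m k p e i + splitTerm m (suc k) (suc p) e i))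
      ≡⟨ ∑<-* (suc m) d _ ⟩
    d * ∑< (suc m) (λ i → k * splitTerm m k p e i + splitTerm m (suc k) (suc p) e i)
      ≡⟨ cong (d *_) (trans (∑<-+ (suc m) _ _)
                            (cong (_+ ∑< (suc m) (splitTerm m (suc k) (suc p) e)) (∑<-* (suc m) k _))) ⟩
    d * (k * ∑< (suc m) (splitTerm m k p e) + ∑< (suc m) (splitTerm m (suc k) (suc p) e)) ∎
    where
    termwise : ∀ i → i ≤ m →
      (m C i) * longerTerm m k p e i ≡ d * (k * splitTerm m k p e i + splitTerm m (suc k) (suc p) e i)
    termwise i i≤m = begin
      (m C i) * (d ^ (suc m ∸ i) * countA i (suc m ∸ i) k p e)
        ≡⟨ cong (λ z → (m C i) * (d ^ z * countA i z k p e)) (+-∸-assoc 1 i≤m) ⟩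
      (m C i) * (d * d ^ (m ∸ i) * countA i (suc (m ∸ i)) k p e)
        ≡⟨ cong (λ z → (m C i) * (d * d ^ (m ∸ i) * z)) (countA-otherFirst i (m ∸ i) k p e) ⟩
      (m C i) * (d * d ^ (m ∸ i) * (k * x + y))
        ≡⟨ solve 6 (λ b d q k x y → b :* (d :* q :* (k :* x :+ y))
                                   := d :* (k :* (b :* (q :* x)) :+ b :* (q :* y)))
                 refl (m C i) d (d ^ (m ∸ i)) k x y ⟩
      d * (k * splitTerm m k p e i + splitTerm m (suc k) (suc p) e i) ∎
      where
      x y : ℕ
      x = countA i (m ∸ i) k p e
      y = countA i (m ∸ i) (suc k) (suc p) e

  split-aFirst : ∀ m k p e →
    ∑< (suc m) (λ i → (m C i) * longerTerm m k p e (suc i))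
    ≡ p * ∑< (suc m) (splitTerm m k (p ∸ 1) 1) + e * ∑< (suc m) (splitTerm m k p 1)
      + ∑< (suc m) (splitTerm m (suc k) p 1)
  split-aFirst m k p e = begin
    ∑< (suc m) (λ i → (m C i) * longerTerm m k p e (suc i))
      ≡⟨ ∑<-cong (suc m) (λ i _ → termwise i) ⟩
    ∑< (suc m) (λ i → p * splitTerm m k (p ∸ 1) 1 i + e * splitTerm m k p 1 i + splitTerm m (suc k) p 1 i)
      ≡⟨ trans (∑<-+ (suc m) _ _) (cong (_+ ∑< (suc m) (splitTerm m (suc k) p 1))
                 (trans (∑<-+ (suc m) _ _) (cong₂ _+_ (∑<-* (suc m) p _) (∑<-* (suc m) e _)))) ⟩
    p * ∑< (suc m) (splitTerm m k (p ∸ 1) 1) + e * ∑< (suc m) (splitTerm m k p 1)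
      + ∑< (suc m) (splitTerm m (suc k) p 1) ∎
    where
    termwise : ∀ i → (m C i) * longerTerm m k p e (suc i)
                     ≡ p * splitTerm m k (p ∸ 1) 1 i + e * splitTerm m k p 1 i + splitTerm m (suc k) p 1 i
    termwise i = solve 7 (λ b q p e x y z → b :* (q :* (p :* x :+ e :* y :+ z))
                                          := p :* (b :* (q :* x)) :+ e :* (b :* (q :* y)) :+ b :* (q :* z))
      refl (m C i) (d ^ (m ∸ i)) p e (countA i (m ∸ i) k (p ∸ 1) 1) (countA i (m ∸ i) k p 1)
      (countA i (m ∸ i) (suc k) p 1)

  count-split : ∀ m k p e → count d m k p e ≡ ∑< (suc m) (splitTerm m k p e)
  count-split zero    k p e = sym (trans (∑<-suc 0 _) (cong (λ z → 1 * (1 * bellExt k 0) + z) (∑<-0 _)))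
  count-split (suc m) k p e = begin
    d * (k * count d m k p e + count d m (suc k) (suc p) e)
      + (p * count d m k (p ∸ 1) 1 + e * count d m k p 1 + count d m (suc k) p 1)
      ≡⟨ cong₂ _+_ (cong (d *_) (cong₂ (λ u w → k * u + w) (split k p e) (split (suc k) (suc p) e)))
                   (cong₂ _+_ (cong₂ _+_ (cong (p *_) (split k (p ∸ 1) 1)) (cong (e *_) (split k p 1)))
                              (split (suc k) p 1)) ⟩
    d * (k * ∑< (suc m) (splitTerm m k p e) + ∑< (suc m) (splitTerm m (suc k) (suc p) e))
      + (p * ∑< (suc m) (splitTerm m k (p ∸ 1) 1) + e * ∑< (suc m) (splitTerm m k p 1)
         + ∑< (suc m) (splitTerm m (suc k) p 1))
      ≡⟨ cong₂ _+_ (split-otherFirst m k p e) (split-aFirst m k p e) ⟨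
    ∑< (suc m) (λ i → (m C i) * longerTerm m k p e i) + ∑< (suc m) (λ i → (m C i) * longerTerm m k p e (suc i))
      ≡⟨ ∑<-pascal m (longerTerm m k p e) ⟨
    ∑< (suc (suc m)) (splitTerm (suc m) k p e) ∎
    where
    split : ∀ k p e → count d m k p e ≡ ∑< (suc m) (splitTerm m k p e)
    split = count-split m

-- Once an a-element has occurred and every block contains one, the i
-- a-coloured elements go to the block of the previous one or to new blocks;
-- s of them open new blocks, in C(i,s) ways.
countA-noFree : ∀ i r k → countA i r k 0 1 ≡ ∑< (suc i) (λ s → (i C s) * bellExt (k + s) r)
countA-noFree zero    r k =
  sym (trans (∑<-suc 0 _) (trans (cong₂ _+_ (trans (*-identityˡ _) (cong (λ z → bellExt z r) (+-identityʳ k)))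
                                            (∑<-0 _))
                                 (+-identityʳ _)))
countA-noFree (suc i) r k = begin
  1 * countA i r k 0 1 + countA i r (suc k) 0 1
    ≡⟨ cong₂ _+_ (trans (*-identityˡ _) (countA-noFree i r k)) (countA-noFree i r (suc k)) ⟩
  ∑< (suc i) (λ s → (i C s) * bellExt (k + s) r) + ∑< (suc i) (λ s → (i C s) * bellExt (suc k + s) r)
    ≡⟨ cong (∑< (suc i) (λ s → (i C s) * bellExt (k + s) r) +_)
            (∑<-cong (suc i) (λ s _ → cong (λ z → (i C s) * bellExt z r) (sym (+-suc k s)))) ⟩
  ∑< (suc i) (λ s → (i C s) * bellExt (k + s) r) + ∑< (suc i) (λ s → (i C s) * bellExt (k + suc s) r)
    ≡⟨ ∑<-pascal i (λ s → bellExt (k + s) r) ⟨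
  ∑< (suc (suc i)) (λ s → (suc i C s) * bellExt (k + s) r) ∎

secondSum : ℕ → ℕ → ℕ
secondSum d n = ∑ 1 n (λ i → ∑ 1 i (λ r → (n C i) * (i C r) * B (n ∸ i) * d ^ (n ∸ r)))

thirdSum : ℕ → ℕ → ℕ
thirdSum d n = ∑ 2 n (λ i → ∑ 2 i (λ ℓ → ∑ 0 (n ∸ i) (λ j →
  (n C i) * ((i ∸ 1) C (ℓ ∸ 1)) * ((n ∸ i) C j) * ℓ ^ j * B (n ∸ i ∸ j) * d ^ (n ∸ i))))

module ClosedForm (d n : ℕ) where

  -- With i + 1 a-coloured elements, split by whether they all lie in one
  -- block (oneBlock) or open at least two blocks (severalBlocks).
  oneBlock : ℕ → ℕ
  oneBlock i = (n C suc i) * (d ^ (n ∸ suc i) * bellExt 1 (n ∸ suc i))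

  severalBlocks : ℕ → ℕ
  severalBlocks i = (n C suc i) * (d ^ (n ∸ suc i) * ∑< i (λ s → (i C suc s) * bellExt (2 + s) (n ∸ suc i)))

  splitTerm-suc : ∀ i → splitTerm d n 0 0 0 (suc i) ≡ oneBlock i + severalBlocks i
  splitTerm-suc i = begin
    (n C suc i) * (d ^ r * countA i r 1 0 1)
      ≡⟨ cong (λ z → (n C suc i) * (d ^ r * z)) (trans (countA-noFree i r 1) (∑<-suc i _)) ⟩
    (n C suc i) * (d ^ r * (1 * bellExt 1 r + rest))
      ≡⟨ solve 4 (λ b D x y → b :* (D :* (con 1 :* x :+ y)) := b :* (D :* x) :+ b :* (D :* y))
               refl (n C suc i) (d ^ r) (bellExt 1 r) rest ⟩
    oneBlock i + severalBlocks i ∎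
    where
    r rest : ℕ
    r = n ∸ suc i
    rest = ∑< i (λ s → (i C suc s) * bellExt (2 + s) r)

  -- Choosing the t + 1 elements of the a-block, then the s - t other
  -- elements joining it, is choosing the s + 1 elements of that block
  -- and then which t + 1 of them are a-coloured.
  reindex : ∀ s t → t ≤ s → s < n →
    (n C suc t) * d ^ (n ∸ suc t) * ((n ∸ suc t) C (s ∸ t)) * B (n ∸ suc t ∸ (s ∸ t))
    ≡ (n C suc s) * (suc s C suc t) * B (n ∸ suc s) * d ^ (n ∸ suc t)
  reindex s t t≤s s<n = begin
    (n C suc t) * d ^ (n ∸ suc t) * ((n ∸ suc t) C a) * B (n ∸ suc t ∸ a)
      ≡⟨ cong (λ z → (n C suc t) * d ^ (n ∸ suc t) * ((n ∸ suc t) C a) * B z) rest≡b ⟩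
    (n C suc t) * d ^ (n ∸ suc t) * ((n ∸ suc t) C a) * B b
      ≡⟨ solve 4 (λ x D y z → x :* D :* y :* z := x :* y :* z :* D)
               refl (n C suc t) (d ^ (n ∸ suc t)) ((n ∸ suc t) C a) (B b) ⟩
    (n C suc t) * ((n ∸ suc t) C a) * B b * d ^ (n ∸ suc t)
      ≡⟨ cong (λ z → z * B b * d ^ (n ∸ suc t)) choose ⟩
    (n C suc s) * (suc s C suc t) * B b * d ^ (n ∸ suc t) ∎
    where
    a b : ℕ
    a = s ∸ t
    b = n ∸ suc s
    1+t+a≡1+s : suc t + a ≡ suc s
    1+t+a≡1+s = cong suc (m+[n∸m]≡n t≤s)
    1+t+[a+b]≡n : suc t + (a + b) ≡ n
    1+t+[a+b]≡n = trans (sym (+-assoc (suc t) a b)) (trans (cong (_+ b) 1+t+a≡1+s) (m+[n∸m]≡n s<n))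
    a+b≡n-1-t : a + b ≡ n ∸ suc t
    a+b≡n-1-t = sym (trans (cong (_∸ suc t) (sym 1+t+[a+b]≡n)) (m+n∸m≡n (suc t) (a + b)))
    rest≡b : n ∸ suc t ∸ a ≡ b
    rest≡b = trans (cong (_∸ a) (sym a+b≡n-1-t)) (m+n∸m≡n a b)
    choose : (n C suc t) * ((n ∸ suc t) C a) ≡ (n C suc s) * (suc s C suc t)
    choose = subst₂ (λ N M → (N C suc t) * (M C a) ≡ (N C suc s) * (suc s C suc t)) 1+t+[a+b]≡n a+b≡n-1-t
      (subst (λ Z → ((suc t + (a + b)) C suc t) * ((a + b) C a) ≡ ((suc t + (a + b)) C Z) * (Z C suc t))
             1+t+a≡1+s (C-subset-of-subset (suc t) a b))

  -- The term of index (t, s) below: t + 1 a-elements in one block which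
  -- also receives s - t elements of other colours.
  oneBlockTerm : ℕ → ℕ → ℕ
  oneBlockTerm t s = (n C suc t) * d ^ (n ∸ suc t) * ((n ∸ suc t) C (s ∸ t)) * B (n ∸ suc t ∸ (s ∸ t))

  oneBlock-row : ∀ i → i < n → oneBlock i ≡ ∑< (n ∸ i) (λ j → oneBlockTerm i (i + j))
  oneBlock-row i i<n = begin
    (n C suc i) * (d ^ r * bellExt 1 r)
      ≡⟨ cong (λ z → (n C suc i) * (d ^ r * z)) (bellExt-closed 1 r) ⟩
    (n C suc i) * (d ^ r * ∑< (suc r) (λ j → (r C j) * 1 ^ j * B (r ∸ j)))
      ≡⟨ trans (cong ((n C suc i) *_) (sym (∑<-* (suc r) (d ^ r) _))) (sym (∑<-* (suc r) (n C suc i) _)) ⟩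
    ∑< (suc r) term
      ≡⟨ cong (λ z → ∑< z term) (+-∸-assoc 1 i<n) ⟨
    ∑< (n ∸ i) term
      ≡⟨ ∑<-cong (n ∸ i) (λ j _ → rearrange j) ⟩
    ∑< (n ∸ i) (λ j → oneBlockTerm i (i + j)) ∎
    where
    r : ℕ
    r = n ∸ suc i
    term : ℕ → ℕ
    term j = (n C suc i) * (d ^ r * ((r C j) * 1 ^ j * B (r ∸ j)))
    rearrange : ∀ j → term j ≡ oneBlockTerm i (i + j)
    rearrange j = begin
      (n C suc i) * (d ^ r * ((r C j) * 1 ^ j * B (r ∸ j)))
        ≡⟨ cong (λ z → (n C suc i) * (d ^ r * ((r C j) * z * B (r ∸ j)))) (^-zeroˡ j) ⟩
      (n C suc i) * (d ^ r * ((r C j) * 1 * B (r ∸ j)))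
        ≡⟨ solve 4 (λ x D y z → x :* (D :* (y :* con 1 :* z)) := x :* D :* y :* z)
                 refl (n C suc i) (d ^ r) (r C j) (B (r ∸ j)) ⟩
      (n C suc i) * d ^ r * (r C j) * B (r ∸ j)
        ≡⟨ cong (λ z → (n C suc i) * d ^ r * (r C z) * B (r ∸ z)) (sym (m+n∸m≡n i j)) ⟩
      oneBlockTerm i (i + j) ∎

  -- The configurations with all a-elements in one block give the second
  -- summand, after summing over the size s + 1 of that block first.
  ∑<-oneBlock : ∑< n oneBlock ≡ secondSum d n
  ∑<-oneBlock = begin
    ∑< n oneBlock
      ≡⟨ ∑<-cong n oneBlock-row ⟩
    ∑< n (λ i → ∑< (n ∸ i) (λ j → oneBlockTerm i (i + j)))
      ≡⟨ ∑<-triangle n oneBlockTerm ⟩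
    ∑< n (λ s → ∑< (suc s) (λ t → oneBlockTerm t s))
      ≡⟨ ∑<-cong n (λ s s<n → ∑<-cong (suc s) (λ t t<1+s → reindex s t (≤-pred t<1+s) s<n)) ⟩
    ∑< n (λ s → ∑< (suc s) (λ t → secondTerm (suc s) (suc t)))
      ≡⟨ trans (∑≡∑< 1 n (λ i → ∑ 1 i (secondTerm i)))
               (∑<-cong n (λ s _ → ∑≡∑< 1 (suc s) (secondTerm (suc s)))) ⟨
    secondSum d n ∎
    where
    secondTerm : ℕ → ℕ → ℕ
    secondTerm i r = (n C i) * (i C r) * B (n ∸ i) * d ^ (n ∸ r)

  thirdTerm : ℕ → ℕ → ℕ → ℕ
  thirdTerm i ℓ j = (n C i) * ((i ∸ 1) C (ℓ ∸ 1)) * ((n ∸ i) C j) * ℓ ^ j * B (n ∸ i ∸ j) * d ^ (n ∸ i)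

  -- With i = t + 2 a-elements and ℓ = s + 2 a-blocks, C(t+1, s+1) chooses
  -- which a-elements open blocks and bellExt ℓ places the other elements.
  severalBlocks-row : ∀ t → severalBlocks (suc t) ≡ ∑ 2 (2 + t) (λ ℓ → ∑ 0 (n ∸ (2 + t)) (thirdTerm (2 + t) ℓ))
  severalBlocks-row t = begin
    (n C (2 + t)) * (d ^ r * ∑< (suc t) (λ s → (suc t C suc s) * bellExt (2 + s) r))
      ≡⟨ trans (cong ((n C (2 + t)) *_) (sym (∑<-* (suc t) (d ^ r) _))) (sym (∑<-* (suc t) (n C (2 + t)) _)) ⟩
    ∑< (suc t) (λ s → (n C (2 + t)) * (d ^ r * ((suc t C suc s) * bellExt (2 + s) r)))
      ≡⟨ ∑<-cong (suc t) (λ s _ → placeOthers s) ⟩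
    ∑< (suc t) (λ s → ∑ 0 r (thirdTerm (2 + t) (2 + s)))
      ≡⟨ ∑≡∑< 2 (2 + t) (λ ℓ → ∑ 0 r (thirdTerm (2 + t) ℓ)) ⟨
    ∑ 2 (2 + t) (λ ℓ → ∑ 0 r (thirdTerm (2 + t) ℓ)) ∎
    where
    r : ℕ
    r = n ∸ (2 + t)
    placeOthers : ∀ s → (n C (2 + t)) * (d ^ r * ((suc t C suc s) * bellExt (2 + s) r))
                        ≡ ∑ 0 r (thirdTerm (2 + t) (2 + s))
    placeOthers s = begin
      (n C (2 + t)) * (d ^ r * ((suc t C suc s) * bellExt (2 + s) r))
        ≡⟨ cong (λ z → (n C (2 + t)) * (d ^ r * ((suc t C suc s) * z))) (bellExt-closed (2 + s) r) ⟩
      (n C (2 + t)) * (d ^ r * ((suc t C suc s) * ∑< (suc r) (λ j → (r C j) * (2 + s) ^ j * B (r ∸ j))))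
        ≡⟨ trans (cong (λ z → (n C (2 + t)) * (d ^ r * z)) (sym (∑<-* (suc r) (suc t C suc s) _)))
                 (trans (cong ((n C (2 + t)) *_) (sym (∑<-* (suc r) (d ^ r) _)))
                        (sym (∑<-* (suc r) (n C (2 + t)) _))) ⟩
      ∑< (suc r) (λ j → (n C (2 + t)) * (d ^ r * ((suc t C suc s) * ((r C j) * (2 + s) ^ j * B (r ∸ j)))))
        ≡⟨ ∑<-cong (suc r) (λ j _ →
             solve 6 (λ a D b c p q → a :* (D :* (b :* (c :* p :* q))) := a :* b :* c :* p :* q :* D)
                   refl (n C (2 + t)) (d ^ r) (suc t C suc s) (r C j) ((2 + s) ^ j) (B (r ∸ j))) ⟩
      ∑< (suc r) (thirdTerm (2 + t) (2 + s))
        ≡⟨ ∑≡∑< 0 r (thirdTerm (2 + t) (2 + s)) ⟨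
      ∑ 0 r (thirdTerm (2 + t) (2 + s)) ∎

-- The configurations with at least two a-blocks give the third summand;
-- a single a-element cannot open two blocks.
∑<-severalBlocks : ∀ d n → ∑< n (ClosedForm.severalBlocks d n) ≡ thirdSum d n
∑<-severalBlocks d zero     = ∑<-0 _
∑<-severalBlocks d (suc n′) = begin
  ∑< (suc n′) severalBlocks
    ≡⟨ ∑<-suc n′ _ ⟩
  severalBlocks 0 + ∑< n′ (λ t → severalBlocks (suc t))
    ≡⟨ cong (_+ ∑< n′ (λ t → severalBlocks (suc t))) noSecondBlock ⟩
  ∑< n′ (λ t → severalBlocks (suc t))
    ≡⟨ ∑<-cong n′ (λ t _ → severalBlocks-row t) ⟩
  ∑< n′ (λ t → ∑ 2 (2 + t) (λ ℓ → ∑ 0 (suc n′ ∸ (2 + t)) (thirdTerm (2 + t) ℓ)))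
    ≡⟨ ∑≡∑< 2 (suc n′) (λ i → ∑ 2 i (λ ℓ → ∑ 0 (suc n′ ∸ i) (thirdTerm i ℓ))) ⟨
  thirdSum d (suc n′) ∎
  where
  open ClosedForm d (suc n′)
  noSecondBlock : severalBlocks 0 ≡ 0
  noSecondBlock = trans (cong (λ z → (suc n′ C 1) * (d ^ n′ * z)) (∑<-0 _))
                        (trans (cong ((suc n′ C 1) *_) (*-zeroʳ (d ^ n′))) (*-zeroʳ (suc n′ C 1)))

count-closedForm : ∀ d n → count d n 0 0 0 ≡ B n * d ^ n + secondSum d n + thirdSum d n
count-closedForm d n = begin
  count d n 0 0 0
    ≡⟨ count-split d n 0 0 0 ⟩
  ∑< (suc n) (splitTerm d n 0 0 0)
    ≡⟨ ∑<-suc n _ ⟩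
  splitTerm d n 0 0 0 0 + ∑< n (λ i → splitTerm d n 0 0 0 (suc i))
    ≡⟨ cong₂ _+_ noA (trans (∑<-cong n (λ i _ → splitTerm-suc i)) (∑<-+ n oneBlock severalBlocks)) ⟩
  B n * d ^ n + (∑< n oneBlock + ∑< n severalBlocks)
    ≡⟨ cong (B n * d ^ n +_) (cong₂ _+_ ∑<-oneBlock (∑<-severalBlocks d n)) ⟩
  B n * d ^ n + (secondSum d n + thirdSum d n)
    ≡⟨ +-assoc (B n * d ^ n) _ _ ⟨
  B n * d ^ n + secondSum d n + thirdSum d n ∎
  where
  open ClosedForm d n
  -- no a-coloured element: a partition of [n] coloured with d colours
  noA : splitTerm d n 0 0 0 0 ≡ B n * d ^ n
  noA = trans (*-identityˡ _) (trans (cong (d ^ n *_) (bellExt-0 n)) (*-comm (d ^ n) (B n)))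

module Scan {c : ℕ} (a : Fin c) where

  AIn : ∀ {m} → ℕ → Vec ℕ m → Vec (Fin c) m → Set
  AIn x []      []        = ⊥
  AIn x (y ∷ v) (κ ∷ col) = (κ ≡ a × y ≡ x) ⊎ AIn x v col

  Pattern21 : ∀ {m} → ℕ → Vec ℕ m → Vec (Fin c) m → Set
  Pattern21 x []      []        = ⊥
  Pattern21 x (y ∷ v) (κ ∷ col) = (κ ≡ a × y ≢ x × AIn x v col) ⊎ Pattern21 x v col

  Pattern121 : ∀ {m} → Vec ℕ m → Vec (Fin c) m → Set
  Pattern121 []      []        = ⊥
  Pattern121 (y ∷ v) (κ ∷ col) = (κ ≡ a × Pattern21 y v col) ⊎ Pattern121 v col

  -- The scan remembers the blocks holding an a-entry (marked) and the
  -- block of the previous a-entry (prev).  It rejects at an a-entry that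
  -- returns to a marked block other than prev.
  mark : (ℕ → Bool) → ℕ → ℕ → Bool
  mark marked x y with y ≟ x
  ... | yes _ = true
  ... | no  _ = marked y

  unmarked : ℕ → Bool
  unmarked _ = false

  Clash : (ℕ → Bool) → Maybe ℕ → ℕ → Set
  Clash marked prev y = marked y ≡ true × prev ≢ just y

  Rejects : ∀ {m} → (ℕ → Bool) → Maybe ℕ → Vec ℕ m → Vec (Fin c) m → Set
  Rejects marked prev []      []        = ⊥
  Rejects marked prev (y ∷ v) (κ ∷ col) =
    (κ ≡ a × (Clash marked prev y ⊎ Rejects (mark marked y) (just y) v col))
    ⊎ (κ ≢ a × Rejects marked prev v col)

  -- Auxiliary scans used to analyse Rejects.  ClashWith keeps the marks
  -- fixed; ReturnTo y detects an a-entry in block y preceded by an a-entry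
  -- (or by prev) outside block y.
  ClashWith : ∀ {m} → (ℕ → Bool) → Maybe ℕ → Vec ℕ m → Vec (Fin c) m → Set
  ClashWith marked prev []      []        = ⊥
  ClashWith marked prev (y ∷ v) (κ ∷ col) =
    (κ ≡ a × (Clash marked prev y ⊎ ClashWith marked (just y) v col))
    ⊎ (κ ≢ a × ClashWith marked prev v col)

  ReturnTo : ∀ {m} → ℕ → Maybe ℕ → Vec ℕ m → Vec (Fin c) m → Set
  ReturnTo y prev []      []        = ⊥
  ReturnTo y prev (z ∷ v) (κ ∷ col) =
    (κ ≡ a × ((z ≡ y × prev ≢ just y) ⊎ ReturnTo y (just z) v col))
    ⊎ (κ ≢ a × ReturnTo y prev v col)

  mark-here : ∀ marked x → mark marked x x ≡ true
  mark-here marked x with x ≟ x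
  ... | yes _  = refl
  ... | no x≢x = ⊥-elim (x≢x refl)

  mark-elsewhere : ∀ marked x y → y ≢ x → mark marked x y ≡ marked y
  mark-elsewhere marked x y y≢x with y ≟ x
  ... | yes y≡x = ⊥-elim (y≢x y≡x)
  ... | no  _   = refl

  mark-keeps : ∀ marked x y → marked y ≡ true → mark marked x y ≡ true
  mark-keeps marked x y y-marked with y ≟ x
  ... | yes _ = refl
  ... | no  _ = y-marked

  returnTo⇒aIn : ∀ {m} y prev (v : Vec ℕ m) col → prev ≢ just y → ReturnTo y prev v col → AIn y v col
  returnTo⇒aIn y prev [] [] _ ()
  returnTo⇒aIn y prev (z ∷ v) (κ ∷ col) _ (inj₁ (κ≡a , inj₁ (z≡y , _))) = inj₁ (κ≡a , z≡y)
  returnTo⇒aIn y prev (z ∷ v) (κ ∷ col) _ (inj₁ (κ≡a , inj₂ ret)) with z ≟ y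
  ... | yes z≡y = inj₁ (κ≡a , z≡y)
  ... | no  z≢y = inj₂ (returnTo⇒aIn y (just z) v col (λ eq → z≢y (Maybe.just-injective eq)) ret)
  returnTo⇒aIn y prev (z ∷ v) (κ ∷ col) prev≢y (inj₂ (_ , ret)) = inj₂ (returnTo⇒aIn y prev v col prev≢y ret)

  aIn⇒returnTo : ∀ {m} y prev (v : Vec ℕ m) col → prev ≢ just y → AIn y v col → ReturnTo y prev v col
  aIn⇒returnTo y prev [] [] _ ()
  aIn⇒returnTo y prev (z ∷ v) (κ ∷ col) prev≢y (inj₁ (κ≡a , z≡y)) = inj₁ (κ≡a , inj₁ (z≡y , prev≢y))
  aIn⇒returnTo y prev (z ∷ v) (κ ∷ col) prev≢y (inj₂ inY) with κ ≟ᶠ a | z ≟ y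
  ... | yes κ≡a | yes z≡y = inj₁ (κ≡a , inj₁ (z≡y , prev≢y))
  ... | yes κ≡a | no  z≢y =
    inj₁ (κ≡a , inj₂ (aIn⇒returnTo y (just z) v col (λ eq → z≢y (Maybe.just-injective eq)) inY))
  ... | no  κ≢a | _       = inj₂ (κ≢a , aIn⇒returnTo y prev v col prev≢y inY)

  pattern21⇒aIn : ∀ {m} y (v : Vec ℕ m) col → Pattern21 y v col → AIn y v col
  pattern21⇒aIn y [] [] ()
  pattern21⇒aIn y (z ∷ v) (κ ∷ col) (inj₁ (_ , _ , inY)) = inj₂ inY
  pattern21⇒aIn y (z ∷ v) (κ ∷ col) (inj₂ pat)         = inj₂ (pattern21⇒aIn y v col pat)

  pattern21⇒returnTo : ∀ {m} y (v : Vec ℕ m) col → Pattern21 y v col → ReturnTo y (just y) v col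
  pattern21⇒returnTo y [] [] ()
  pattern21⇒returnTo y (z ∷ v) (κ ∷ col) (inj₁ (κ≡a , z≢y , inY)) =
    inj₁ (κ≡a , inj₂ (aIn⇒returnTo y (just z) v col (λ eq → z≢y (Maybe.just-injective eq)) inY))
  pattern21⇒returnTo y (z ∷ v) (κ ∷ col) (inj₂ pat) with κ ≟ᶠ a | z ≟ y
  ... | yes κ≡a | yes refl = inj₁ (κ≡a , inj₂ (pattern21⇒returnTo y v col pat))
  ... | yes κ≡a | no  z≢y  =
    inj₁ (κ≡a , inj₂ (aIn⇒returnTo y (just z) v col (λ eq → z≢y (Maybe.just-injective eq))
                                    (pattern21⇒aIn y v col pat)))
  ... | no  κ≢a | _        = inj₂ (κ≢a , pattern21⇒returnTo y v col pat)

  returnTo⇒pattern21 : ∀ {m} y (v : Vec ℕ m) col → ReturnTo y (just y) v col → Pattern21 y v col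
  returnTo⇒pattern21 y [] [] ()
  returnTo⇒pattern21 y (z ∷ v) (κ ∷ col) (inj₁ (κ≡a , inj₁ (_ , y≢y))) = ⊥-elim (y≢y refl)
  returnTo⇒pattern21 y (z ∷ v) (κ ∷ col) (inj₁ (κ≡a , inj₂ ret)) with z ≟ y
  ... | yes refl = inj₂ (returnTo⇒pattern21 y v col ret)
  ... | no  z≢y  = inj₁ (κ≡a , z≢y , returnTo⇒aIn y (just z) v col (λ eq → z≢y (Maybe.just-injective eq)) ret)
  returnTo⇒pattern21 y (z ∷ v) (κ ∷ col) (inj₂ (_ , ret)) = inj₂ (returnTo⇒pattern21 y v col ret)

  clashWith-mark⁻ : ∀ {m} marked y prev (v : Vec ℕ m) col →
    ClashWith (mark marked y) prev v col → ClashWith marked prev v col ⊎ ReturnTo y prev v col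
  clashWith-mark⁻ marked y prev [] [] ()
  clashWith-mark⁻ marked y prev (z ∷ v) (κ ∷ col) (inj₁ (κ≡a , inj₁ (z-marked , prev≢z))) with z ≟ y
  ... | yes refl = inj₂ (inj₁ (κ≡a , inj₁ (refl , prev≢z)))
  ... | no  _    = inj₁ (inj₁ (κ≡a , inj₁ (z-marked , prev≢z)))
  clashWith-mark⁻ marked y prev (z ∷ v) (κ ∷ col) (inj₁ (κ≡a , inj₂ cl))
    with clashWith-mark⁻ marked y (just z) v col cl
  ... | inj₁ cl′ = inj₁ (inj₁ (κ≡a , inj₂ cl′))
  ... | inj₂ ret = inj₂ (inj₁ (κ≡a , inj₂ ret))
  clashWith-mark⁻ marked y prev (z ∷ v) (κ ∷ col) (inj₂ (κ≢a , cl))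
    with clashWith-mark⁻ marked y prev v col cl
  ... | inj₁ cl′ = inj₁ (inj₂ (κ≢a , cl′))
  ... | inj₂ ret = inj₂ (inj₂ (κ≢a , ret))

  clashWith-mark⁺ : ∀ {m} marked y prev (v : Vec ℕ m) col →
    ClashWith marked prev v col ⊎ ReturnTo y prev v col → ClashWith (mark marked y) prev v col
  clashWith-mark⁺ marked y prev [] [] (inj₁ ())
  clashWith-mark⁺ marked y prev [] [] (inj₂ ())
  clashWith-mark⁺ marked y prev (z ∷ v) (κ ∷ col) (inj₁ (inj₁ (κ≡a , inj₁ (z-marked , prev≢z)))) =
    inj₁ (κ≡a , inj₁ (mark-keeps marked y z z-marked , prev≢z))
  clashWith-mark⁺ marked y prev (z ∷ v) (κ ∷ col) (inj₁ (inj₁ (κ≡a , inj₂ cl))) =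
    inj₁ (κ≡a , inj₂ (clashWith-mark⁺ marked y (just z) v col (inj₁ cl)))
  clashWith-mark⁺ marked y prev (z ∷ v) (κ ∷ col) (inj₁ (inj₂ (κ≢a , cl))) =
    inj₂ (κ≢a , clashWith-mark⁺ marked y prev v col (inj₁ cl))
  clashWith-mark⁺ marked y prev (z ∷ v) (κ ∷ col) (inj₂ (inj₁ (κ≡a , inj₁ (refl , prev≢z)))) =
    inj₁ (κ≡a , inj₁ (mark-here marked z , prev≢z))
  clashWith-mark⁺ marked y prev (z ∷ v) (κ ∷ col) (inj₂ (inj₁ (κ≡a , inj₂ ret))) =
    inj₁ (κ≡a , inj₂ (clashWith-mark⁺ marked y (just z) v col (inj₂ ret)))
  clashWith-mark⁺ marked y prev (z ∷ v) (κ ∷ col) (inj₂ (inj₂ (κ≢a , ret))) =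
    inj₂ (κ≢a , clashWith-mark⁺ marked y prev v col (inj₂ ret))

  rejects⁻ : ∀ {m} marked prev (v : Vec ℕ m) col →
    Rejects marked prev v col → Pattern121 v col ⊎ ClashWith marked prev v col
  rejects⁻ marked prev [] [] ()
  rejects⁻ marked prev (y ∷ v) (κ ∷ col) (inj₁ (κ≡a , inj₁ clash)) = inj₂ (inj₁ (κ≡a , inj₁ clash))
  rejects⁻ marked prev (y ∷ v) (κ ∷ col) (inj₁ (κ≡a , inj₂ rej)) with rejects⁻ (mark marked y) (just y) v col rej
  ... | inj₁ pat = inj₁ (inj₂ pat)
  ... | inj₂ cl with clashWith-mark⁻ marked y (just y) v col cl
  ...   | inj₁ cl′ = inj₂ (inj₁ (κ≡a , inj₂ cl′))
  ...   | inj₂ ret = inj₁ (inj₁ (κ≡a , returnTo⇒pattern21 y v col ret))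
  rejects⁻ marked prev (y ∷ v) (κ ∷ col) (inj₂ (κ≢a , rej)) with rejects⁻ marked prev v col rej
  ... | inj₁ pat = inj₁ (inj₂ pat)
  ... | inj₂ cl  = inj₂ (inj₂ (κ≢a , cl))

  rejects⁺ : ∀ {m} marked prev (v : Vec ℕ m) col →
    Pattern121 v col ⊎ ClashWith marked prev v col → Rejects marked prev v col
  rejects⁺ marked prev [] [] (inj₁ ())
  rejects⁺ marked prev [] [] (inj₂ ())
  rejects⁺ marked prev (y ∷ v) (κ ∷ col) (inj₁ (inj₁ (κ≡a , pat))) =
    inj₁ (κ≡a , inj₂ (rejects⁺ (mark marked y) (just y) v col
                        (inj₂ (clashWith-mark⁺ marked y (just y) v col
                                 (inj₂ (pattern21⇒returnTo y v col pat))))))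
  rejects⁺ marked prev (y ∷ v) (κ ∷ col) (inj₁ (inj₂ pat)) with κ ≟ᶠ a
  ... | yes κ≡a = inj₁ (κ≡a , inj₂ (rejects⁺ (mark marked y) (just y) v col (inj₁ pat)))
  ... | no  κ≢a = inj₂ (κ≢a , rejects⁺ marked prev v col (inj₁ pat))
  rejects⁺ marked prev (y ∷ v) (κ ∷ col) (inj₂ (inj₁ (κ≡a , inj₁ clash))) = inj₁ (κ≡a , inj₁ clash)
  rejects⁺ marked prev (y ∷ v) (κ ∷ col) (inj₂ (inj₁ (κ≡a , inj₂ cl))) =
    inj₁ (κ≡a , inj₂ (rejects⁺ (mark marked y) (just y) v col
                        (inj₂ (clashWith-mark⁺ marked y (just y) v col (inj₁ cl)))))
  rejects⁺ marked prev (y ∷ v) (κ ∷ col) (inj₂ (inj₂ (κ≢a , cl))) = inj₂ (κ≢a , rejects⁺ marked prev v col (inj₂ cl))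

  noClash-unmarked : ∀ {m} prev (v : Vec ℕ m) col → ¬ ClashWith unmarked prev v col
  noClash-unmarked prev [] [] ()
  noClash-unmarked prev (y ∷ v) (κ ∷ col) (inj₁ (_ , inj₁ (() , _)))
  noClash-unmarked prev (y ∷ v) (κ ∷ col) (inj₁ (_ , inj₂ cl)) = noClash-unmarked (just y) v col cl
  noClash-unmarked prev (y ∷ v) (κ ∷ col) (inj₂ (_ , cl))      = noClash-unmarked prev v col cl

  aIn-at : ∀ {m} x (v : Vec ℕ m) col (z : Fin m) → lookup col z ≡ a → lookup v z ≡ x → AIn x v col
  aIn-at x (y ∷ v) (κ ∷ col) fz     κ≡a y≡x = inj₁ (κ≡a , y≡x)
  aIn-at x (y ∷ v) (κ ∷ col) (fs z) κ≡a y≡x = inj₂ (aIn-at x v col z κ≡a y≡x)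

  pattern21-at : ∀ {m} x (v : Vec ℕ m) col (y z : Fin m) → toℕ y < toℕ z →
    lookup col y ≡ a → lookup col z ≡ a → lookup v y ≢ x → lookup v z ≡ x → Pattern21 x v col
  pattern21-at x (w ∷ v) (κ ∷ col) fz     (fs z) _         cy cz vy≢x vz≡x =
    inj₁ (cy , vy≢x , aIn-at x v col z cz vz≡x)
  pattern21-at x (w ∷ v) (κ ∷ col) (fs y) (fs z) (s≤s y<z) cy cz vy≢x vz≡x =
    inj₂ (pattern21-at x v col y z y<z cy cz vy≢x vz≡x)

  contains⇒pattern121 : ∀ {m} (v : Vec ℕ m) col → Contains121 a (v , col) → Pattern121 v col
  contains⇒pattern121 (w ∷ v) (κ ∷ col) (fz , fs y , fs z , _ , y<z , cx , cy , cz , vx≡vz , vy≢vx) =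
    inj₁ (cx , pattern21-at w v col y z (≤-pred y<z) cy cz vy≢vx (sym vx≡vz))
  contains⇒pattern121 (w ∷ v) (κ ∷ col) (fs x , fs y , fs z , s≤s x<y , s≤s y<z , cx , cy , cz , vx≡vz , vy≢vx) =
    inj₂ (contains⇒pattern121 v col (x , y , z , x<y , y<z , cx , cy , cz , vx≡vz , vy≢vx))

  aIn-position : ∀ {m} x (v : Vec ℕ m) col → AIn x v col → Σ (Fin m) λ z → lookup col z ≡ a × lookup v z ≡ x
  aIn-position x [] [] ()
  aIn-position x (y ∷ v) (κ ∷ col) (inj₁ (κ≡a , y≡x)) = fz , κ≡a , y≡x
  aIn-position x (y ∷ v) (κ ∷ col) (inj₂ inX) with aIn-position x v col inX
  ... | z , cz , vz≡x = fs z , cz , vz≡x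

  pattern21-positions : ∀ {m} x (v : Vec ℕ m) col → Pattern21 x v col →
    Σ (Fin m) λ y → Σ (Fin m) λ z →
      toℕ y < toℕ z × lookup col y ≡ a × lookup col z ≡ a × lookup v y ≢ x × lookup v z ≡ x
  pattern21-positions x [] [] ()
  pattern21-positions x (w ∷ v) (κ ∷ col) (inj₁ (κ≡a , w≢x , inX)) with aIn-position x v col inX
  ... | z , cz , vz≡x = fz , fs z , s≤s z≤n , κ≡a , cz , w≢x , vz≡x
  pattern21-positions x (w ∷ v) (κ ∷ col) (inj₂ pat) with pattern21-positions x v col pat
  ... | y , z , y<z , cy , cz , vy≢x , vz≡x = fs y , fs z , s≤s y<z , cy , cz , vy≢x , vz≡x

  pattern121⇒contains : ∀ {m} (v : Vec ℕ m) col → Pattern121 v col → Contains121 a (v , col)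
  pattern121⇒contains [] [] ()
  pattern121⇒contains (w ∷ v) (κ ∷ col) (inj₁ (κ≡a , pat)) with pattern21-positions w v col pat
  ... | y , z , y<z , cy , cz , vy≢w , vz≡w =
    fz , fs y , fs z , s≤s z≤n , s≤s y<z , κ≡a , cy , cz , sym vz≡w , vy≢w
  pattern121⇒contains (w ∷ v) (κ ∷ col) (inj₂ pat) with pattern121⇒contains v col pat
  ... | x , y , z , x<y , y<z , cx , cy , cz , vx≡vz , vy≢vx =
    fs x , fs y , fs z , s≤s x<y , s≤s y<z , cx , cy , cz , vx≡vz , vy≢vx

  avoids⇔accepted : ∀ {m} (v : Vec ℕ m) col → (¬ Contains121 a (v , col)) ⇔ (¬ Rejects unmarked nothing v col)
  avoids⇔accepted v col = mk⇔ accept avoid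
    where
    accept : ¬ Contains121 a (v , col) → ¬ Rejects unmarked nothing v col
    accept avoids rej with rejects⁻ unmarked nothing v col rej
    ... | inj₁ pat = avoids (pattern121⇒contains v col pat)
    ... | inj₂ cl  = noClash-unmarked nothing v col cl
    avoid : ¬ Rejects unmarked nothing v col → ¬ Contains121 a (v , col)
    avoid accepted contains =
      accepted (rejects⁺ unmarked nothing v col (inj₁ (contains⇒pattern121 v col contains)))

when : ∀ {P : Set} → Dec P → ℕ → ℕ
when (yes _) n = n
when (no  _) n = 0

when-yes : ∀ {P : Set} (d : Dec P) n → P → when d n ≡ n
when-yes (yes _) n _  = refl
when-yes (no ¬p) n p  = ⊥-elim (¬p p)

when-no : ∀ {P : Set} (d : Dec P) n → ¬ P → when d n ≡ 0
when-no (yes p) n ¬p = ⊥-elim (¬p p)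
when-no (no  _) n _  = refl

module _ {A : Set} where

  ∑∈ : List A → (A → ℕ) → ℕ
  ∑∈ []       g = 0
  ∑∈ (x ∷ xs) g = g x + ∑∈ xs g

  ∑∈-cong : ∀ xs {g h : A → ℕ} → (∀ x → g x ≡ h x) → ∑∈ xs g ≡ ∑∈ xs h
  ∑∈-cong []       g≗h = refl
  ∑∈-cong (x ∷ xs) g≗h = cong₂ _+_ (g≗h x) (∑∈-cong xs g≗h)

  ∑∈-const : ∀ xs n → ∑∈ xs (λ _ → n) ≡ length xs * n
  ∑∈-const []       n = refl
  ∑∈-const (x ∷ xs) n = cong (n +_) (∑∈-const xs n)

  ∑∈-filter : ∀ {P : A → Set} (P? : ∀ x → Dec (P x)) xs g → ∑∈ (filter P? xs) g ≡ ∑∈ xs (λ x → when (P? x) (g x))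
  ∑∈-filter P? []       g = refl
  ∑∈-filter P? (x ∷ xs) g with P? x
  ... | yes _ = cong (g x +_) (∑∈-filter P? xs g)
  ... | no  _ = ∑∈-filter P? xs g

∑∈-upTo : ∀ n (g : ℕ → ℕ) → ∑∈ (upTo n) g ≡ ∑< n g
∑∈-upTo n g = go n (λ i → i)
  where
  go : ∀ n (h : ℕ → ℕ) → ∑∈ (applyUpTo h n) g ≡ ∑< n (λ i → g (h i))
  go zero    h = sym (∑<-0 _)
  go (suc n) h = trans (cong (g (h 0) +_) (go n (λ i → h (suc i)))) (sym (∑<-suc n _))

module _ {A B : Set} where

  ∈-concatMap-find : ∀ (f : A → List B) xs {b} → b ∈ concatMap f xs → ∃ λ x → x ∈ xs × b ∈ f x
  ∈-concatMap-find f xs b∈ = find (∈-concatMap⁻ f {xs = xs} b∈)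

  ∈-concatMap-intro : ∀ (f : A → List B) {xs x b} → x ∈ xs → b ∈ f x → b ∈ concatMap f xs
  ∈-concatMap-intro f x∈ b∈ = ∈-concatMap⁺ f (lose x∈ b∈)

  length-concatMap : ∀ (f : A → List B) xs → length (concatMap f xs) ≡ ∑∈ xs (λ x → length (f x))
  length-concatMap f []       = refl
  length-concatMap f (x ∷ xs) = trans (length-++ (f x)) (cong (length (f x) +_) (length-concatMap f xs))

  concatMap-unique : (tag : B → A) (f : A → List B) (xs : List A) → Unique xs → (∀ x → Unique (f x)) →
                     (∀ x b → b ∈ f x → tag b ≡ x) → Unique (concatMap f xs)
  concatMap-unique tag f []       _            f-unique tagged = []
  concatMap-unique tag f (x ∷ xs) (x∉xs ∷ xs!) f-unique tagged =
    ++⁺ (f-unique x) (concatMap-unique tag f xs xs! f-unique tagged) disjoint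
    where
    disjoint : ∀ {b} → ¬ (b ∈ f x × b ∈ concatMap f xs)
    disjoint (b∈fx , b∈rest) with ∈-concatMap-find f xs b∈rest
    ... | y , y∈xs , b∈fy = All.lookup x∉xs y∈xs (trans (sym (tagged x _ b∈fx)) (tagged y _ b∈fy))

isFree : (ℕ → Bool) → ℕ → ℕ
isFree marked x = if marked x then 0 else 1

free : ℕ → (ℕ → Bool) → ℕ
free k marked = ∑< k (isFree marked)

seen : Maybe ℕ → ℕ
seen nothing  = 0
seen (just _) = 1

isPrev : Maybe ℕ → ℕ → ℕ
isPrev nothing  x = 0
isPrev (just j) x with x ≟ j
... | yes _ = 1
... | no  _ = 0

isPrev-self : ∀ x → isPrev (just x) x ≡ 1
isPrev-self x with x ≟ x
... | yes _  = refl
... | no x≢x = ⊥-elim (x≢x refl)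

isPrev-other : ∀ prev x → prev ≢ just x → isPrev prev x ≡ 0
isPrev-other nothing  x _ = refl
isPrev-other (just j) x j≢x with x ≟ j
... | yes refl = ⊥-elim (j≢x refl)
... | no  _    = refl

∑<-isPrev : ∀ k j → j < k → ∑< k (isPrev (just j)) ≡ 1
∑<-isPrev (suc k) j j<1+k with m≤n⇒m<n∨m≡n (≤-pred j<1+k)
... | inj₁ j<k = begin
  ∑< (suc k) (isPrev (just j))
    ≡⟨ ∑<-last k _ ⟩
  ∑< k (isPrev (just j)) + isPrev (just j) k
    ≡⟨ cong₂ _+_ (∑<-isPrev k j j<k) (isPrev-other (just j) k (λ eq → <⇒≢ j<k (Maybe.just-injective eq))) ⟩
  1 ∎
... | inj₂ refl = begin
  ∑< (suc j) (isPrev (just j))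
    ≡⟨ ∑<-last j _ ⟩
  ∑< j (isPrev (just j)) + isPrev (just j) j
    ≡⟨ cong₂ _+_ (∑<-zero j (λ i i<j → isPrev-other (just j) i (λ eq → <⇒≢ i<j (sym (Maybe.just-injective eq)))))
                 (isPrev-self j) ⟩
  1 ∎

free-cong : ∀ k marked marked′ → (∀ x → x < k → marked x ≡ marked′ x) → free k marked ≡ free k marked′
free-cong k marked marked′ agree = ∑<-cong k (λ x x<k → cong (λ b → if b then 0 else 1) (agree x x<k))

module Marks {c : ℕ} (a : Fin c) where
  open Scan a

  free-mark-new : ∀ k marked → free k (mark marked k) ≡ free k marked
  free-mark-new k marked = free-cong k _ _ (λ x x<k → mark-elsewhere marked k x (<⇒≢ x<k))

  free-mark-marked : ∀ k marked x → marked x ≡ true → free k (mark marked x) ≡ free k marked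
  free-mark-marked k marked x x-marked = free-cong k _ _ agree
    where
    agree : ∀ y → y < k → mark marked x y ≡ marked y
    agree y _ with y ≟ x
    ... | yes refl = sym x-marked
    ... | no  _    = refl

  free-mark-free : ∀ k marked x → x < k → marked x ≡ false → free k (mark marked x) + 1 ≡ free k marked
  free-mark-free (suc k) marked x x<1+k x-free with m≤n⇒m<n∨m≡n (≤-pred x<1+k)
  ... | inj₁ x<k = begin
    free (suc k) (mark marked x) + 1
      ≡⟨ cong (_+ 1) (∑<-last k _) ⟩
    free k (mark marked x) + isFree (mark marked x) k + 1
      ≡⟨ cong (λ b → free k (mark marked x) + (if b then 0 else 1) + 1)
              (mark-elsewhere marked x k (λ k≡x → <⇒≢ x<k (sym k≡x))) ⟩
    free k (mark marked x) + isFree marked k + 1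
      ≡⟨ +-comm-last (free k (mark marked x)) (isFree marked k) ⟩
    free k (mark marked x) + 1 + isFree marked k
      ≡⟨ cong (_+ isFree marked k) (free-mark-free k marked x x<k x-free) ⟩
    free k marked + isFree marked k
      ≡⟨ ∑<-last k _ ⟨
    free (suc k) marked ∎
    where
    +-comm-last : ∀ u w → u + w + 1 ≡ u + 1 + w
    +-comm-last u w = trans (+-assoc u w 1) (trans (cong (u +_) (+-comm w 1)) (sym (+-assoc u 1 w)))
  ... | inj₂ refl = begin
    free (suc x) (mark marked x) + 1
      ≡⟨ cong (_+ 1) (∑<-last x _) ⟩
    free x (mark marked x) + isFree (mark marked x) x + 1
      ≡⟨ cong₂ (λ u b → u + (if b then 0 else 1) + 1) (free-mark-new x marked) (mark-here marked x) ⟩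
    free x marked + 0 + 1
      ≡⟨ cong (_+ 1) (+-identityʳ _) ⟩
    free x marked + 1
      ≡⟨ cong (λ b → free x marked + (if b then 0 else 1)) x-free ⟨
    free x marked + isFree marked x
      ≡⟨ ∑<-last x _ ⟨
    free (suc x) marked ∎

module Enumeration (c′ : ℕ) (a : Fin (suc c′)) where
  open Scan a
  open Marks a

  Coloured : ℕ → Set
  Coloured m = ColoredData m (suc c′)

  cons : ∀ {m} → ℕ → Fin (suc c′) → Coloured m → Coloured (suc m)
  cons x κ (v , col) = x ∷ v , κ ∷ col

  cons-injective : ∀ {m x κ} {p q : Coloured m} → cons x κ p ≡ cons x κ q → p ≡ q
  cons-injective {p = v , col} {q = .v , .col} refl = refl

  cons-colour : ∀ {m x y κ μ} {p q : Coloured m} → cons x κ p ≡ cons y μ q → κ ≡ μ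
  cons-colour {p = v , col} {q = .v , .col} refl = refl

  record ScanState : Set where
    field
      blocks            : ℕ
      marked            : ℕ → Bool
      prev              : Maybe ℕ
      unopened-unmarked : ∀ y → blocks ≤ y → marked y ≡ false
      prev-marked       : ∀ j → prev ≡ just j → j < blocks × marked j ≡ true
  open ScanState

  initial : ScanState
  initial = record
    { blocks = 0 ; marked = unmarked ; prev = nothing
    ; unopened-unmarked = λ _ _ → refl ; prev-marked = λ _ () }

  afterOther : ScanState → ℕ → ScanState
  afterOther s x = record
    { blocks = blocks s ⊔ suc x ; marked = marked s ; prev = prev s
    ; unopened-unmarked = λ y le → unopened-unmarked s y (≤-trans (m≤m⊔n (blocks s) (suc x)) le)
    ; prev-marked = λ j eq → ≤-trans (proj₁ (prev-marked s j eq)) (m≤m⊔n (blocks s) (suc x))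
                           , proj₂ (prev-marked s j eq) }

  afterA : ScanState → ℕ → ScanState
  afterA s x = record
    { blocks = blocks s ⊔ suc x ; marked = mark (marked s) x ; prev = just x
    ; unopened-unmarked = λ y le →
        trans (mark-elsewhere (marked s) x y (λ y≡x → <⇒≢ (≤-trans (m≤n⊔m (blocks s) (suc x)) le) (sym y≡x)))
              (unopened-unmarked s y (≤-trans (m≤m⊔n (blocks s) (suc x)) le))
    ; prev-marked = λ { j refl → m≤n⊔m (blocks s) (suc j) , mark-here (marked s) j } }

  allowedA? : (s : ScanState) (x : ℕ) → Dec (¬ Clash (marked s) (prev s) x)
  allowedA? s x = ¬? ((marked s x Bool.≟ true) ×-dec ¬? (Maybe.≡-dec _≟_ (prev s) (just x)))

  otherColours : List (Fin (suc c′))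
  otherColours = map (punchIn a) (allFin c′)

  aExtensions : ∀ {m} → (ScanState → List (Coloured m)) → ScanState → List (Coloured (suc m))
  aExtensions rest s =
    concatMap (λ x → map (cons x a) (rest (afterA s x))) (filter (allowedA? s) (upTo (suc (blocks s))))

  otherExtensionsWith : ∀ {m} → (ScanState → List (Coloured m)) → ScanState → Fin (suc c′) → List (Coloured (suc m))
  otherExtensionsWith rest s κ = concatMap (λ x → map (cons x κ) (rest (afterOther s x))) (upTo (suc (blocks s)))

  otherExtensions : ∀ {m} → (ScanState → List (Coloured m)) → ScanState → List (Coloured (suc m))
  otherExtensions rest s = concatMap (otherExtensionsWith rest s) otherColours

  enumerate : ∀ m → ScanState → List (Coloured m)
  enumerate zero    s = ([] , []) ∷ []
  enumerate (suc m) s = aExtensions (enumerate m) s ++ otherExtensions (enumerate m) s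

  ∈-aExtensions⁻ : ∀ {m} (rest : ScanState → List (Coloured m)) s {p} → p ∈ aExtensions rest s →
    ∃ λ x → ∃ λ q → x < suc (blocks s) × ¬ Clash (marked s) (prev s) x × q ∈ rest (afterA s x) × p ≡ cons x a q
  ∈-aExtensions⁻ rest s p∈ with ∈-concatMap-find _ (filter (allowedA? s) (upTo (suc (blocks s)))) p∈
  ... | x , x∈ , p∈x with ∈-map⁻ (cons x a) p∈x | ∈-filter⁻ (allowedA? s) {xs = upTo (suc (blocks s))} x∈
  ...   | q , q∈ , p≡ | x∈upTo , allowed = x , q , ∈-upTo⁻ x∈upTo , allowed , q∈ , p≡

  ∈-aExtensions⁺ : ∀ {m} (rest : ScanState → List (Coloured m)) s {x q} → x < suc (blocks s) →
    ¬ Clash (marked s) (prev s) x → q ∈ rest (afterA s x) → cons x a q ∈ aExtensions rest s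
  ∈-aExtensions⁺ rest s {x} x<1+k allowed q∈ =
    ∈-concatMap-intro _ (∈-filter⁺ (allowedA? s) (∈-upTo⁺ x<1+k) allowed) (∈-map⁺ (cons x a) q∈)

  ∈-otherExtensions⁻ : ∀ {m} (rest : ScanState → List (Coloured m)) s {p} → p ∈ otherExtensions rest s →
    ∃ λ x → ∃ λ q → ∃ λ κ → κ ≢ a × x < suc (blocks s) × q ∈ rest (afterOther s x) × p ≡ cons x κ q
  ∈-otherExtensions⁻ rest s p∈ with ∈-concatMap-find (otherExtensionsWith rest s) otherColours p∈
  ... | κ , κ∈ , p∈κ with ∈-concatMap-find _ (upTo (suc (blocks s))) p∈κ | ∈-map⁻ (punchIn a) κ∈
  ...   | x , x∈ , p∈x | j , _ , refl with ∈-map⁻ (cons x (punchIn a j)) p∈x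
  ...     | q , q∈ , p≡ = x , q , punchIn a j , punchInᵢ≢i a j , ∈-upTo⁻ x∈ , q∈ , p≡

  ∈-otherExtensions⁺ : ∀ {m} (rest : ScanState → List (Coloured m)) s {x q κ} → κ ≢ a → x < suc (blocks s) →
    q ∈ rest (afterOther s x) → cons x κ q ∈ otherExtensions rest s
  ∈-otherExtensions⁺ rest s {x} {κ = κ} κ≢a x<1+k q∈ =
    ∈-concatMap-intro (otherExtensionsWith rest s) κ∈
      (∈-concatMap-intro _ (∈-upTo⁺ x<1+k) (∈-map⁺ (cons x κ) q∈))
    where
    κ∈ : κ ∈ otherColours
    κ∈ = subst (_∈ otherColours) (punchIn-punchOut (λ a≡κ → κ≢a (sym a≡κ)))
               (∈-map⁺ (punchIn a) (∈-allFin _))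

  ⊔-below : ∀ {k x} → x < k → k ⊔ suc x ≡ k
  ⊔-below = m≥n⇒m⊔n≡m

  ⊔-new : ∀ k → k ⊔ suc k ≡ suc k
  ⊔-new k = m≤n⇒m⊔n≡n (n≤1+n k)

  rgs-∷⁺ : ∀ {m k x} {v : Vec ℕ m} → x < suc k → RGS (k ⊔ suc x) v → RGS k (x ∷ v)
  rgs-∷⁺ {k = k} {x} {v} x<1+k rgs with m≤n⇒m<n∨m≡n (≤-pred x<1+k)
  ... | inj₁ x<k  = old x<k (subst (λ z → RGS z v) (⊔-below x<k) rgs)
  ... | inj₂ refl = new (subst (λ z → RGS z v) (⊔-new x) rgs)

  rgs-∷⁻ : ∀ {m k x} {v : Vec ℕ m} → RGS k (x ∷ v) → x < suc k × RGS (k ⊔ suc x) v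
  rgs-∷⁻ {k = k} {v = v} (old x<k rgs) = m<n⇒m<1+n x<k , subst (λ z → RGS z v) (sym (⊔-below x<k)) rgs
  rgs-∷⁻ {k = k} {v = v} (new rgs)     = ≤-refl , subst (λ z → RGS z v) (sym (⊔-new k)) rgs

  enumerate-sound : ∀ m s (p : Coloured m) → p ∈ enumerate m s →
    RGS (blocks s) (proj₁ p) × ¬ Rejects (marked s) (prev s) (proj₁ p) (proj₂ p)
  enumerate-sound zero    s ([] , []) _ = done , λ ()
  enumerate-sound (suc m) s p p∈ with ∈-++⁻ (aExtensions (enumerate m) s) p∈
  ... | inj₁ p∈A with ∈-aExtensions⁻ (enumerate m) s p∈A
  ...   | x , q , x<1+k , allowed , q∈ , refl with enumerate-sound m (afterA s x) q q∈
  ...     | rgs , accepted = rgs-∷⁺ x<1+k rgs , λ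
    { (inj₁ (_ , inj₁ clash)) → allowed clash
    ; (inj₁ (_ , inj₂ rej))   → accepted rej
    ; (inj₂ (a≢a , _))        → a≢a refl }
  enumerate-sound (suc m) s p p∈ | inj₂ p∈O with ∈-otherExtensions⁻ (enumerate m) s p∈O
  ...   | x , q , κ , κ≢a , x<1+k , q∈ , refl with enumerate-sound m (afterOther s x) q q∈
  ...     | rgs , accepted = rgs-∷⁺ x<1+k rgs , λ
    { (inj₁ (κ≡a , _))  → κ≢a κ≡a
    ; (inj₂ (_ , rej))  → accepted rej }

  enumerate-complete : ∀ m s (p : Coloured m) → RGS (blocks s) (proj₁ p) →
    ¬ Rejects (marked s) (prev s) (proj₁ p) (proj₂ p) → p ∈ enumerate m s
  enumerate-complete zero    s ([] , [])               _   _        = here refl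
  enumerate-complete (suc m) s (x ∷ v , κ ∷ col) rgs accepted with rgs-∷⁻ rgs | κ ≟ᶠ a
  ... | x<1+k , rgs′ | yes refl =
    ∈-++⁺ˡ (∈-aExtensions⁺ (enumerate m) s x<1+k (λ clash → accepted (inj₁ (refl , inj₁ clash)))
             (enumerate-complete m (afterA s x) (v , col) rgs′ (λ rej → accepted (inj₁ (refl , inj₂ rej)))))
  ... | x<1+k , rgs′ | no κ≢a =
    ∈-++⁺ʳ (aExtensions (enumerate m) s)
      (∈-otherExtensions⁺ (enumerate m) s κ≢a x<1+k
        (enumerate-complete m (afterOther s x) (v , col) rgs′ (λ rej → accepted (inj₂ (κ≢a , rej)))))

  headBlock : ∀ {m} → Coloured (suc m) → ℕ
  headBlock (x ∷ _ , _) = x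

  headColour : ∀ {m} → Coloured (suc m) → Fin (suc c′)
  headColour (_ , κ ∷ _) = κ

  headBlock-cons : ∀ {m} (L : List (Coloured m)) κ x b → b ∈ map (cons x κ) L → headBlock b ≡ x
  headBlock-cons L κ x b b∈ with ∈-map⁻ (cons x κ) b∈
  ... | (v , col) , _ , refl = refl

  headColour-otherExtensionsWith : ∀ {m} (rest : ScanState → List (Coloured m)) s κ b →
    b ∈ otherExtensionsWith rest s κ → headColour b ≡ κ
  headColour-otherExtensionsWith rest s κ b b∈ with ∈-concatMap-find _ (upTo (suc (blocks s))) b∈
  ... | x , _ , b∈x with ∈-map⁻ (cons x κ) b∈x
  ...   | (v , col) , _ , refl = refl

  enumerate-unique : ∀ m s → Unique (enumerate m s)
  enumerate-unique zero    s = [] ∷ []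
  enumerate-unique (suc m) s = ++⁺ aUnique otherUnique disjoint
    where
    rest! : ∀ s → Unique (enumerate m s)
    rest! = enumerate-unique m
    aUnique : Unique (aExtensions (enumerate m) s)
    aUnique = concatMap-unique headBlock _ (filter (allowedA? s) (upTo (suc (blocks s))))
      (filter⁺ (allowedA? s) (upTo⁺ _)) (λ x → map⁺ cons-injective (rest! (afterA s x)))
      (λ x → headBlock-cons (enumerate m (afterA s x)) a x)
    otherUnique : Unique (otherExtensions (enumerate m) s)
    otherUnique = concatMap-unique headColour (otherExtensionsWith (enumerate m) s) otherColours
      (map⁺ (λ {i} {j} → punchIn-injective a i j) (allFin⁺ c′))
      (λ κ → concatMap-unique headBlock _ (upTo (suc (blocks s))) (upTo⁺ _)
               (λ x → map⁺ cons-injective (rest! (afterOther s x)))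
               (λ x → headBlock-cons (enumerate m (afterOther s x)) κ x))
      (headColour-otherExtensionsWith (enumerate m) s)
    -- the two parts differ in the colour of the first entry
    disjoint : ∀ {p} → ¬ (p ∈ aExtensions (enumerate m) s × p ∈ otherExtensions (enumerate m) s)
    disjoint (p∈A , p∈O) with ∈-aExtensions⁻ (enumerate m) s p∈A | ∈-otherExtensions⁻ (enumerate m) s p∈O
    ... | _ , _ , _ , _ , _ , p≡ | _ , _ , _ , κ≢a , _ , _ , p≡′ = κ≢a (sym (cons-colour (trans (sym p≡) p≡′)))

  -- The number of continuations only depends on the summary (k, p, e) of
  -- the state, and satisfies the recurrence of count.
  countFrom : ℕ → ScanState → ℕ
  countFrom m s = count c′ m (blocks s) (free (blocks s) (marked s)) (seen (prev s))

  ∑<-isPrev-state : ∀ s → ∑< (blocks s) (isPrev (prev s)) ≡ seen (prev s)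
  ∑<-isPrev-state s with prev s in prev≡
  ... | nothing = ∑<-zero (blocks s) (λ _ _ → refl)
  ... | just j  = ∑<-isPrev (blocks s) j (proj₁ (prev-marked s j prev≡))

  module Lengths {m} (rest : ScanState → List (Coloured m))
                     (rest-length : ∀ s → length (rest s) ≡ countFrom m s) (s : ScanState) where

    k p e : ℕ
    k = blocks s
    p = free k (marked s)
    e = seen (prev s)

    length-otherExtensionsWith : ∀ κ → length (otherExtensionsWith rest s κ)
                                     ≡ k * count c′ m k p e + count c′ m (suc k) (suc p) e
    length-otherExtensionsWith κ = begin
      length (otherExtensionsWith rest s κ)
        ≡⟨ length-concatMap (λ x → map (cons x κ) (rest (afterOther s x))) (upTo (suc k)) ⟩
      ∑∈ (upTo (suc k)) (λ x → length (map (cons x κ) (rest (afterOther s x))))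
        ≡⟨ ∑∈-cong (upTo (suc k)) (λ x → trans (length-map (cons x κ) (rest (afterOther s x)))
                                               (rest-length (afterOther s x))) ⟩
      ∑∈ (upTo (suc k)) (λ x → countFrom m (afterOther s x))
        ≡⟨ ∑∈-upTo (suc k) _ ⟩
      ∑< (suc k) (λ x → countFrom m (afterOther s x))
        ≡⟨ ∑<-last k _ ⟩
      ∑< k (λ x → countFrom m (afterOther s x)) + countFrom m (afterOther s k)
        ≡⟨ cong₂ _+_ (trans (∑<-cong k (λ x x<k → cong (λ z → count c′ m z (free z (marked s)) e) (⊔-below x<k)))
                            (∑<-const k _))
                     (cong (λ z → count c′ m z (free z (marked s)) e) (⊔-new k)) ⟩
      k * count c′ m k p e + count c′ m (suc k) (free (suc k) (marked s)) e
        ≡⟨ cong (λ z → k * count c′ m k p e + count c′ m (suc k) z e) newFree ⟩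
      k * count c′ m k p e + count c′ m (suc k) (suc p) e ∎
      where
      newFree : free (suc k) (marked s) ≡ suc p
      newFree = trans (∑<-last k _)
        (trans (cong (λ b → p + (if b then 0 else 1)) (unopened-unmarked s k ≤-refl)) (+-comm p 1))

    length-otherExtensions : length (otherExtensions rest s) ≡ c′ * (k * count c′ m k p e + count c′ m (suc k) (suc p) e)
    length-otherExtensions = begin
      length (otherExtensions rest s)
        ≡⟨ length-concatMap (otherExtensionsWith rest s) otherColours ⟩
      ∑∈ otherColours (λ κ → length (otherExtensionsWith rest s κ))
        ≡⟨ ∑∈-cong otherColours length-otherExtensionsWith ⟩
      ∑∈ otherColours (λ _ → k * count c′ m k p e + count c′ m (suc k) (suc p) e)
        ≡⟨ ∑∈-const otherColours _ ⟩
      length otherColours * (k * count c′ m k p e + count c′ m (suc k) (suc p) e)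
        ≡⟨ cong (_* (k * count c′ m k p e + count c′ m (suc k) (suc p) e))
                (trans (length-map (punchIn a) (allFin c′)) (length-tabulate {n = c′} (λ i → i))) ⟩
      c′ * (k * count c′ m k p e + count c′ m (suc k) (suc p) e) ∎

    afterFree afterPrev : ℕ
    afterFree = count c′ m k (p ∸ 1) 1
    afterPrev = count c′ m k p 1

    true≢false : true ≢ false
    true≢false ()

    -- an a-entry in block x < k: a free block leaves p - 1 free blocks, the
    -- previous a-block leaves p, any other block is forbidden
    aTerm : ℕ → ℕ
    aTerm x = when (allowedA? s x) (length (rest (afterA s x)))

    aTerm-old : ∀ x → x < k → aTerm x ≡ afterFree * isFree (marked s) x + afterPrev * isPrev (prev s) x
    aTerm-old x x<k = byMark (marked s x) refl (Maybe.≡-dec _≟_ (prev s) (just x))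
      where
      afterA≡ : length (rest (afterA s x)) ≡ count c′ m k (free k (mark (marked s) x)) 1
      afterA≡ = trans (rest-length (afterA s x))
                      (cong (λ z → count c′ m z (free z (mark (marked s) x)) 1) (⊔-below x<k))
      byMark : ∀ b → marked s x ≡ b → Dec (prev s ≡ just x) →
               aTerm x ≡ afterFree * isFree (marked s) x + afterPrev * isPrev (prev s) x
      byMark false x-free _ = begin
        aTerm x
          ≡⟨ when-yes (allowedA? s x) _ (λ (x-marked , _) → true≢false (trans (sym x-marked) x-free)) ⟩
        length (rest (afterA s x))
          ≡⟨ afterA≡ ⟩
        count c′ m k (free k (mark (marked s) x)) 1
          ≡⟨ cong (λ z → count c′ m k z 1) (+-cancelʳ-≡ _ _ _ (trans (free-mark-free k (marked s) x x<k x-free)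
                                                                   (sym (m∸n+n≡m {p} {1} p≥1)))) ⟩
        afterFree
          ≡⟨ solve 2 (λ x y → x := x :* con 1 :+ y :* con 0) refl afterFree afterPrev ⟩
        afterFree * 1 + afterPrev * 0
          ≡⟨ cong₂ (λ u w → afterFree * u + afterPrev * w) (cong (λ b → if b then 0 else 1) x-free)
                                           (isPrev-other (prev s) x prevElsewhere) ⟨
        afterFree * isFree (marked s) x + afterPrev * isPrev (prev s) x ∎
        where
        prevElsewhere : prev s ≢ just x
        prevElsewhere prev≡x = true≢false (trans (sym (proj₂ (prev-marked s x prev≡x))) x-free)
        p≥1 : 1 ≤ p
        p≥1 = subst (1 ≤_) (free-mark-free k (marked s) x x<k x-free) (m≤n+m 1 _)
      byMark true x-marked (yes prev≡x) = begin
        aTerm x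
          ≡⟨ when-yes (allowedA? s x) _ (λ (_ , prev≢x) → prev≢x prev≡x) ⟩
        length (rest (afterA s x))
          ≡⟨ afterA≡ ⟩
        count c′ m k (free k (mark (marked s) x)) 1
          ≡⟨ cong (λ z → count c′ m k z 1) (free-mark-marked k (marked s) x x-marked) ⟩
        afterPrev
          ≡⟨ solve 2 (λ x y → y := x :* con 0 :+ y :* con 1) refl afterFree afterPrev ⟩
        afterFree * 0 + afterPrev * 1
          ≡⟨ cong₂ (λ u w → afterFree * u + afterPrev * w) (cong (λ b → if b then 0 else 1) x-marked)
                                           (trans (cong (λ j → isPrev j x) prev≡x) (isPrev-self x)) ⟨
        afterFree * isFree (marked s) x + afterPrev * isPrev (prev s) x ∎
      byMark true x-marked (no prev≢x) = begin
        aTerm x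
          ≡⟨ when-no (allowedA? s x) _ (λ allowed → allowed (x-marked , prev≢x)) ⟩
        0
          ≡⟨ solve 2 (λ x y → con 0 := x :* con 0 :+ y :* con 0) refl afterFree afterPrev ⟩
        afterFree * 0 + afterPrev * 0
          ≡⟨ cong₂ (λ u w → afterFree * u + afterPrev * w) (cong (λ b → if b then 0 else 1) x-marked)
                                           (isPrev-other (prev s) x prev≢x) ⟨
        afterFree * isFree (marked s) x + afterPrev * isPrev (prev s) x ∎

    aTerm-new : aTerm k ≡ count c′ m (suc k) p 1
    aTerm-new = begin
      aTerm k
        ≡⟨ when-yes (allowedA? s k) _
                    (λ (k-marked , _) → true≢false (trans (sym k-marked) (unopened-unmarked s k ≤-refl))) ⟩
      length (rest (afterA s k))
        ≡⟨ rest-length (afterA s k) ⟩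
      count c′ m (k ⊔ suc k) (free (k ⊔ suc k) (mark (marked s) k)) 1
        ≡⟨ cong (λ z → count c′ m z (free z (mark (marked s) k)) 1) (⊔-new k) ⟩
      count c′ m (suc k) (free (suc k) (mark (marked s) k)) 1
        ≡⟨ cong (λ z → count c′ m (suc k) z 1) newFree ⟩
      count c′ m (suc k) p 1 ∎
      where
      newFree : free (suc k) (mark (marked s) k) ≡ p
      newFree = trans (∑<-last k _)
        (trans (cong₂ (λ u b → u + (if b then 0 else 1)) (free-mark-new k (marked s)) (mark-here (marked s) k))
               (+-identityʳ p))

    length-aExtensions : length (aExtensions rest s)
                         ≡ p * count c′ m k (p ∸ 1) 1 + e * count c′ m k p 1 + count c′ m (suc k) p 1
    length-aExtensions = begin
      length (aExtensions rest s)
        ≡⟨ length-concatMap (λ x → map (cons x a) (rest (afterA s x))) (filter (allowedA? s) (upTo (suc k))) ⟩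
      ∑∈ (filter (allowedA? s) (upTo (suc k))) (λ x → length (map (cons x a) (rest (afterA s x))))
        ≡⟨ ∑∈-cong (filter (allowedA? s) (upTo (suc k))) (λ x → length-map (cons x a) (rest (afterA s x))) ⟩
      ∑∈ (filter (allowedA? s) (upTo (suc k))) (λ x → length (rest (afterA s x)))
        ≡⟨ ∑∈-filter (allowedA? s) (upTo (suc k)) _ ⟩
      ∑∈ (upTo (suc k)) aTerm
        ≡⟨ ∑∈-upTo (suc k) aTerm ⟩
      ∑< (suc k) aTerm
        ≡⟨ ∑<-last k aTerm ⟩
      ∑< k aTerm + aTerm k
        ≡⟨ cong₂ _+_ oldBlocks aTerm-new ⟩
      p * count c′ m k (p ∸ 1) 1 + e * count c′ m k p 1 + count c′ m (suc k) p 1 ∎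
      where
      oldBlocks : ∑< k aTerm ≡ p * afterFree + e * afterPrev
      oldBlocks = begin
        ∑< k aTerm
          ≡⟨ ∑<-cong k aTerm-old ⟩
        ∑< k (λ x → afterFree * isFree (marked s) x + afterPrev * isPrev (prev s) x)
          ≡⟨ trans (∑<-+ k _ _) (cong₂ _+_ (∑<-* k afterFree _) (∑<-* k afterPrev _)) ⟩
        afterFree * p + afterPrev * ∑< k (isPrev (prev s))
          ≡⟨ cong (λ z → afterFree * p + afterPrev * z) (∑<-isPrev-state s) ⟩
        afterFree * p + afterPrev * e
          ≡⟨ cong₂ _+_ (*-comm afterFree p) (*-comm afterPrev e) ⟩
        p * afterFree + e * afterPrev ∎

  enumerate-length : ∀ m s → length (enumerate m s) ≡ countFrom m s
  enumerate-length zero    s = refl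
  enumerate-length (suc m) s = begin
    length (aExtensions (enumerate m) s ++ otherExtensions (enumerate m) s)
      ≡⟨ length-++ (aExtensions (enumerate m) s) ⟩
    length (aExtensions (enumerate m) s) + length (otherExtensions (enumerate m) s)
      ≡⟨ cong₂ _+_ length-aExtensions length-otherExtensions ⟩
    aPart + otherPart
      ≡⟨ +-comm aPart otherPart ⟩
    countFrom (suc m) s ∎
    where
    open Lengths (enumerate m) (enumerate-length m) s
    aPart otherPart : ℕ
    aPart     = p * count c′ m k (p ∸ 1) 1 + e * count c′ m k p 1 + count c′ m (suc k) p 1
    otherPart = c′ * (k * count c′ m k p e + count c′ m (suc k) (suc p) e)

theorem5p4 : (n c : ℕ) → 1 ≤ n → 1 ≤ c → (a : Fin c) →
    HasCard (InAvoidSet {n} {c} a)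
      (B n * (c ∸ 1) ^ n
       + ∑ 1 n (λ i → ∑ 1 i (λ r →
           (n C i) * (i C r) * B (n ∸ i) * (c ∸ 1) ^ (n ∸ r)))
       + ∑ 2 n (λ i → ∑ 2 i (λ ℓ → ∑ 0 (n ∸ i) (λ j →
           (n C i) * ((i ∸ 1) C (ℓ ∸ 1)) * ((n ∸ i) C j) * ℓ ^ j
             * B (n ∸ i ∸ j) * (c ∸ 1) ^ (n ∸ i)))))
theorem5p4 n zero     _ _ ()
theorem5p4 n (suc c′) _ _ a =
  enumerate n initial , enumerate-unique n initial , (λ p → mk⇔ (sound p) (complete p)) , size
  where
  open Enumeration c′ a
  open Scan a using (avoids⇔accepted)
  sound : ∀ p → p ∈ enumerate n initial → InAvoidSet a p
  sound (v , col) p∈ with enumerate-sound n initial (v , col) p∈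
  ... | rgs , accepted = rgs , Equivalence.from (avoids⇔accepted v col) accepted
  complete : ∀ p → InAvoidSet a p → p ∈ enumerate n initial
  complete (v , col) (rgs , avoids) =
    enumerate-complete n initial (v , col) rgs (Equivalence.to (avoids⇔accepted v col) avoids)
  -- the initial state has no blocks and no a-entry; here c - 1 = c′
  size : length (enumerate n initial) ≡ B n * c′ ^ n + secondSum c′ n + thirdSum c′ n
  size = trans (enumerate-length n initial)
               (trans (cong (λ z → count c′ n 0 z 0) (∑<-0 _)) (count-closedForm c′ n))
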